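{- Let $n\geq1$ and $r\geq3$. Then $$\det(1;T_r^{(r)},T_{r+2}^{(r)},\ldots,T_{2n+r-2}^{(r)})=\begin{cases}(-1)^{n-1}k_n^{(r)}, & \text{if } r\text{ is odd};\\ (-1)^{n-1}\displaystyle\sum_{i=0}^{n-1}a_i^{(r/2)}a_{n-1-i}^{(r/2)}, & \text{if } r \text{ is even},\end{cases}$$ where the numbers $k_n^{(r)}$ are defined by $$\sum_{n\geq1}k_n^{(r)}x^n=\frac{x+x^{\frac{r+1}{2}}}{1-2x+x^2-x^{\frac{r+1}{2}}-x^r}.$$ In particular, for $r=3$, $$\det(1;T_3,T_5,\ldots,T_{2n+1})=(-2)^{n-1}\sum_{i=0}^{n-1}2^{ -i-\lfloor i/2\rfloor}\binom{n-1-i}{\lfloor i/2\rfloor}.$$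
   Context: For $r\ge3$, the generalized $r$-tribonacci numbers are defined by $T_0^{(r)}=\cdots=T_{r-2}^{(r)}=0$, $T_{r-1}^{(r)}=1$, and $T_n^{(r)}=T_{n-1}^{(r)}+T_{n-2}^{(r)}+T_{n-r}^{(r)}$ for $n\geq r$; $T_n=T_n^{(3)}$ are the ordinary tribonacci numbers ($T_0=T_1=0$, $T_2=1$, $T_n=T_{n-1}+T_{n-2}+T_{n-3}$). For an integer $m\ge2$, $a_0^{(m)}=\cdots=a_{m-1}^{(m)}=1$ and $a_n^{(m)}=a_{n-1}^{(m)}+a_{n-m}^{(m)}$ for $n\ge m$. For numbers $a_0,\ldots,a_n$, $\det(a_0;a_1,\ldots,a_n)$ denotes the determinant of the $n\times n$ Toeplitz--Hessenberg matrix whose $(i,j)$ entry is $a_{i-j+1}$ if $i-j+1\ge0$ and $0$ otherwise; here the $k$-th entry after the semicolon is $T_{r+2k-2}^{(r)}$. -}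

module Defs where

open import Data.Nat as ℕ using (ℕ; zero; suc; _∸_; _<ᵇ_; _≡ᵇ_; _≤ᵇ_)
open import Data.Bool using (if_then_else_)
open import Data.Fin as Fin using (Fin; toℕ; punchIn)
open import Data.Integer as ℤ using (ℤ; +_; -_)
open import Data.Rational as ℚ using (ℚ)

-- Defined by recursion with fuel; fuel (suc n) is always sufficient, so
-- tribR r n satisfies T_0=..=T_{r-2}=0, T_{r-1}=1,
-- T_n = T_{n-1}+T_{n-2}+T_{n-r} (n ≥ r) for r ≥ 3.
tribGo : ℕ → ℕ → ℕ → ℕ
tribGo r zero    n = 0
tribGo r (suc f) n =
  if n <ᵇ (r ∸ 1) then 0
  else if n ≡ᵇ (r ∸ 1) then 1
  else ℕ._+_ (ℕ._+_ (tribGo r f (n ∸ 1)) (tribGo r f (n ∸ 2))) (tribGo r f (n ∸ r))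

tribR : ℕ → ℕ → ℕ
tribR r n = tribGo r (suc n) n

aGo : ℕ → ℕ → ℕ → ℕ
aGo m zero    n = 0
aGo m (suc f) n =
  if n <ᵇ m then 1
  else ℕ._+_ (aGo m f (n ∸ 1)) (aGo m f (n ∸ m))

aSeq : ℕ → ℕ → ℕ
aSeq m n = aGo m (suc n) n

sumℤ : (n : ℕ) → (Fin n → ℤ) → ℤ
sumℤ zero    f = + 0
sumℤ (suc n) f = ℤ._+_ (f Fin.zero) (sumℤ n (λ i → f (Fin.suc i)))

sumℚ : (n : ℕ) → (Fin n → ℚ) → ℚ
sumℚ zero    f = ℚ.0ℚ
sumℚ (suc n) f = ℚ._+_ (f Fin.zero) (sumℚ n (λ i → f (Fin.suc i)))

det : (n : ℕ) → (Fin n → Fin n → ℤ) → ℤ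
det zero    M = + 1
det (suc n) M =
  sumℤ (suc n) (λ j →
    ℤ._*_ (ℤ._*_ ((- (+ 1)) ℤ.^ toℕ j) (M Fin.zero j))
          (det n (λ i k → M (Fin.suc i) (punchIn j k))))

-- det(a_0; a_1, ..., a_n): determinant of the n×n Toeplitz–Hessenberg matrix
-- with (i,j) entry a_{i-j+1} if i-j+1 ≥ 0 and 0 otherwise
-- (0-indexed rows/columns here; i-j+1 is unchanged by the shift).
thDet : (n : ℕ) → (ℕ → ℤ) → ℤ
thDet n a = det n (λ i j →
  if toℕ j ≤ᵇ suc (toℕ i) then a (suc (toℕ i) ∸ toℕ j) else + 0)

-- The sequence (1; T^(r)_r, T^(r)_{r+2}, ..., ): entry 0 is 1,
-- entry k ≥ 1 is T^(r)_{r+2k-2}.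
tribEntries : ℕ → ℕ → ℤ
tribEntries r zero    = + 1
tribEntries r (suc k) = + tribR r (ℕ._+_ r (ℕ._*_ 2 k))

-- Formal power series as coefficient sequences ℕ → ℤ; Cauchy product.
conv : (ℕ → ℤ) → (ℕ → ℤ) → ℕ → ℤ
conv f g m = sumℤ (suc m) (λ i → ℤ._*_ (f (toℕ i)) (g (m ∸ toℕ i)))

-- coefficient of x^e in the monomial x^e0
δ : ℕ → ℕ → ℤ
δ e m = if e ≡ᵇ m then + 1 else + 0

-- Denominator 1 - 2x + x^2 - x^h - x^r  and numerator x + x^h (h = (r+1)/2).
kDen : ℕ → ℕ → ℕ → ℤ
kDen h r m = ℤ._-_ (ℤ._-_ (ℤ._+_ (ℤ._-_ (δ 0 m) (ℤ._*_ (+ 2) (δ 1 m))) (δ 2 m)) (δ h m)) (δ r m)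

kNum : ℕ → ℕ → ℤ
kNum h m = ℤ._+_ (δ 1 m) (δ h m)

powℚ : ℚ → ℕ → ℚ
powℚ q zero    = ℚ.1ℚ
powℚ q (suc e) = ℚ._*_ q (powℚ q e)

module Submission where

open import Defs
open import Data.Nat using (ℕ; suc; _∸_; _≤_; _/_)
open import Data.Fin using (toℕ)
open import Data.Product using (_×_)
open import Data.Integer as ℤ using (ℤ; +_; -_)
open import Data.Rational as ℚ using (ℚ; ½)
open import Data.Nat.Combinatorics using (_C_)
open import Relation.Binary.PropositionalEquality using (_≡_)

-- 1. Trudi's formula (Hessenberg): if a₀ = 1, then Σ (-1)ⁿ det(a₀; a₁,…,aₙ) xⁿ
--    is the inverse of A = Σ aₙ xⁿ.  So it suffices to find the inverse of A.
-- 2. The recurrence of T^(r) says (1 - x - x² - x^r)·T = x^{r-1} (Recurrences).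
--    Multiplying by a polynomial M with M·(1 - x - x² - x^r) = Q′(x²) and taking
--    the even or odd part (Bisection) gives Q′·(T_ε, T_{ε+2}, …) for
--    r = ε + 2p + 2; as (T_{ε+2j})ⱼ = x^p·(A - 1), this determines Q′·A
--    (EntriesGF): A = Den/Q′ for r = 2p + 3, where Den is the denominator of
--    Σ kₙ xⁿ (OddCase), and A = (1 - x - x^s)²/Q′ for r = 2s (EvenCase).
-- 3. Odd r: Den·(1 - K) = Den - Num = Q′, so 1 - K is the inverse of A.
--    Even r: Σ a^(s)ₙ xⁿ = 1/(1 - x - x^s), hence
--    (1 - x - x^s)²·(1 - x·(Σ a^(s)ₙ xⁿ)²) = Q′ and 1 - x·(Σ a^(s)ₙ xⁿ)² is the
--    inverse of A; its coefficients are the stated convolutions.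
-- 4. r = 3 (TribonacciClosedForm): here k_{n+3} = 2k_{n+2} + kₙ, and 2^N times
--    the binomial sum satisfies the same recurrence (by Pascal's rule) with
--    the same initial values.

module PowerSeries where

  open import Data.Nat as ℕ using (ℕ; zero; suc; _∸_)
  open import Data.Nat.Induction using (<-rec)
  open import Data.Fin as Fin using (Fin; toℕ)
  open import Data.Integer as ℤ using (ℤ; +_; -_; _+_; _*_; _-_)
  open import Data.Integer.Properties
  open import Data.Integer.Solver using (module +-*-Solver)
  open +-*-Solver
  open import Relation.Binary.PropositionalEquality

  Series : Set
  Series = ℕ → ℤ

  infix 4 _≈_
  _≈_ : Series → Series → Set
  f ≈ g = ∀ m → f m ≡ g m

  tl : Series → Series
  tl f m = f (suc m)

  zeroS : Series
  zeroS _ = + 0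

  addS subS : Series → Series → Series
  addS f g m = f m + g m
  subS f g m = f m - g m

  scal : ℤ → Series → Series
  scal c f m = c * f m

  sh : ℕ → Series → Series
  sh zero    g         = g
  sh (suc e) g zero    = + 0
  sh (suc e) g (suc m) = sh e g m

  sumℤ-cong : ∀ n (f g : Fin n → ℤ) → (∀ i → f i ≡ g i) → sumℤ n f ≡ sumℤ n g
  sumℤ-cong zero    f g e = refl
  sumℤ-cong (suc n) f g e = cong₂ _+_ (e Fin.zero) (sumℤ-cong n _ _ (λ i → e (Fin.suc i)))

  sumℤ-zero : ∀ n (f : Fin n → ℤ) → (∀ i → f i ≡ + 0) → sumℤ n f ≡ + 0
  sumℤ-zero zero    f e = refl
  sumℤ-zero (suc n) f e = cong₂ _+_ (e Fin.zero) (sumℤ-zero n _ (λ i → e (Fin.suc i)))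

  conv-cong : ∀ f f′ g g′ → f ≈ f′ → g ≈ g′ → conv f g ≈ conv f′ g′
  conv-cong f f′ g g′ ef eg m =
    sumℤ-cong (suc m) _ _ (λ i → cong₂ _*_ (ef (toℕ i)) (eg (m ∸ toℕ i)))

  conv-congˡ : ∀ f f′ g → f ≈ f′ → conv f g ≈ conv f′ g
  conv-congˡ f f′ g ef = conv-cong f f′ g g ef (λ _ → refl)

  conv-congʳ : ∀ f g g′ → g ≈ g′ → conv f g ≈ conv f g′
  conv-congʳ f g g′ eg = conv-cong f f g g′ (λ _ → refl) eg

  conv-zeroˡ : ∀ g → conv zeroS g ≈ zeroS
  conv-zeroˡ g m = sumℤ-zero (suc m) _ (λ i → refl)

  -- Ring laws of the Cauchy product.  conv-last peels off the last term
  -- instead of the first one, which gives commutativity.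
  conv-last : ∀ f g m → conv f g (suc m) ≡ conv f (tl g) m + f (suc m) * g 0
  conv-last f g zero = lem (f 0) (f 1) (g 0) (g 1)
    where
    lem : ∀ a b c d → a * d + (b * c + + 0) ≡ (a * d + + 0) + b * c
    lem = solve 4 (λ a b c d → a :* d :+ (b :* c :+ con (+ 0)) := (a :* d :+ con (+ 0)) :+ b :* c) refl
  conv-last f g (suc m) =
    trans (cong (_+_ (f 0 * g (suc (suc m)))) (conv-last (tl f) g m))
          (sym (+-assoc (f 0 * g (suc (suc m))) _ _))

  conv-comm : ∀ f g → conv f g ≈ conv g f
  conv-comm f g zero    = cong (_+ + 0) (*-comm (f 0) (g 0))
  conv-comm f g (suc m) = begin
    f 0 * g (suc m) + conv (tl f) g m ≡⟨ cong (_+_ (f 0 * g (suc m))) (conv-comm (tl f) g m) ⟩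
    f 0 * g (suc m) + conv g (tl f) m ≡⟨ +-comm (f 0 * g (suc m)) (conv g (tl f) m) ⟩
    conv g (tl f) m + f 0 * g (suc m) ≡⟨ cong (_+_ (conv g (tl f) m)) (*-comm (f 0) _) ⟩
    conv g (tl f) m + g (suc m) * f 0 ≡⟨ sym (conv-last g f m) ⟩
    conv g f (suc m)                  ∎
    where open ≡-Reasoning

  conv-addˡ : ∀ f g h → conv (addS f g) h ≈ addS (conv f h) (conv g h)
  conv-addˡ f g h zero = lem (f 0) (g 0) (h 0)
    where
    lem : ∀ a b c → (a + b) * c + + 0 ≡ (a * c + + 0) + (b * c + + 0)
    lem = solve 3 (λ a b c → (a :+ b) :* c :+ con (+ 0) := (a :* c :+ con (+ 0)) :+ (b :* c :+ con (+ 0))) refl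
  conv-addˡ f g h (suc m) =
    trans (cong (_+_ ((f 0 + g 0) * h (suc m))) (conv-addˡ (tl f) (tl g) h m))
          (lem (f 0) (g 0) (h (suc m)) (conv (tl f) h m) (conv (tl g) h m))
    where
    lem : ∀ a b c x y → (a + b) * c + (x + y) ≡ (a * c + x) + (b * c + y)
    lem = solve 5 (λ a b c x y → (a :+ b) :* c :+ (x :+ y) := (a :* c :+ x) :+ (b :* c :+ y)) refl

  conv-subˡ : ∀ f g h → conv (subS f g) h ≈ subS (conv f h) (conv g h)
  conv-subˡ f g h zero = lem (f 0) (g 0) (h 0)
    where
    lem : ∀ a b c → (a - b) * c + + 0 ≡ (a * c + + 0) - (b * c + + 0)
    lem = solve 3 (λ a b c → (a :- b) :* c :+ con (+ 0) := (a :* c :+ con (+ 0)) :- (b :* c :+ con (+ 0))) refl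
  conv-subˡ f g h (suc m) =
    trans (cong (_+_ ((f 0 - g 0) * h (suc m))) (conv-subˡ (tl f) (tl g) h m))
          (lem (f 0) (g 0) (h (suc m)) (conv (tl f) h m) (conv (tl g) h m))
    where
    lem : ∀ a b c x y → (a - b) * c + (x - y) ≡ (a * c + x) - (b * c + y)
    lem = solve 5 (λ a b c x y → (a :- b) :* c :+ (x :- y) := (a :* c :+ x) :- (b :* c :+ y)) refl

  conv-scalˡ : ∀ c f h → conv (scal c f) h ≈ scal c (conv f h)
  conv-scalˡ c f h zero = lem c (f 0) (h 0)
    where
    lem : ∀ c a b → (c * a) * b + + 0 ≡ c * (a * b + + 0)
    lem = solve 3 (λ c a b → (c :* a) :* b :+ con (+ 0) := c :* (a :* b :+ con (+ 0))) refl
  conv-scalˡ c f h (suc m) =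
    trans (cong (_+_ ((c * f 0) * h (suc m))) (conv-scalˡ c (tl f) h m))
          (lem c (f 0) (h (suc m)) (conv (tl f) h m))
    where
    lem : ∀ c a b x → (c * a) * b + c * x ≡ c * (a * b + x)
    lem = solve 4 (λ c a b x → (c :* a) :* b :+ c :* x := c :* (a :* b :+ x)) refl

  conv-addʳ : ∀ f g h → conv h (addS f g) ≈ addS (conv h f) (conv h g)
  conv-addʳ f g h m =
    trans (conv-comm h (addS f g) m)
          (trans (conv-addˡ f g h m) (cong₂ _+_ (conv-comm f h m) (conv-comm g h m)))

  conv-subʳ : ∀ f g h → conv h (subS f g) ≈ subS (conv h f) (conv h g)
  conv-subʳ f g h m =
    trans (conv-comm h (subS f g) m)
          (trans (conv-subˡ f g h m) (cong₂ _-_ (conv-comm f h m) (conv-comm g h m)))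

  conv-assoc : ∀ f g h → conv (conv f g) h ≈ conv f (conv g h)
  conv-assoc f g h zero = lem (f 0) (g 0) (h 0)
    where
    lem : ∀ a b c → (a * b + + 0) * c + + 0 ≡ a * (b * c + + 0) + + 0
    lem = solve 3 (λ a b c → (a :* b :+ con (+ 0)) :* c :+ con (+ 0) := a :* (b :* c :+ con (+ 0)) :+ con (+ 0)) refl
  conv-assoc f g h (suc m) = begin
    conv f g 0 * h (suc m) + conv (tl (conv f g)) h m
      ≡⟨ cong (_+_ (conv f g 0 * h (suc m))) (conv-addˡ (scal (f 0) (tl g)) (conv (tl f) g) h m) ⟩
    conv f g 0 * h (suc m) + (conv (scal (f 0) (tl g)) h m + conv (conv (tl f) g) h m)
      ≡⟨ cong₂ (λ x y → conv f g 0 * h (suc m) + (x + y))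
               (conv-scalˡ (f 0) (tl g) h m) (conv-assoc (tl f) g h m) ⟩
    conv f g 0 * h (suc m) + (f 0 * conv (tl g) h m + conv (tl f) (conv g h) m)
      ≡⟨ lem (f 0) (g 0) (h (suc m)) (conv (tl g) h m) (conv (tl f) (conv g h) m) ⟩
    f 0 * (g 0 * h (suc m) + conv (tl g) h m) + conv (tl f) (conv g h) m
      ∎
    where
    open ≡-Reasoning
    lem : ∀ a b c x y → (a * b + + 0) * c + (a * x + y) ≡ a * (b * c + x) + y
    lem = solve 5 (λ a b c x y → (a :* b :+ con (+ 0)) :* c :+ (a :* x :+ y) := a :* (b :* c :+ x) :+ y) refl

  conv-identityˡ : ∀ g → conv (δ 0) g ≈ g
  conv-identityˡ g zero    = trans (+-identityʳ _) (*-identityˡ (g 0))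
  conv-identityˡ g (suc m) =
    trans (cong (_+_ (+ 1 * g (suc m))) (conv-zeroˡ g m)) (trans (+-identityʳ _) (*-identityˡ _))

  conv-identityʳ : ∀ g → conv g (δ 0) ≈ g
  conv-identityʳ g m = trans (conv-comm g (δ 0) m) (conv-identityˡ g m)

  conv-monomial : ∀ e g → conv (δ e) g ≈ sh e g
  conv-monomial zero    g         = conv-identityˡ g
  conv-monomial (suc e) g zero    = refl
  conv-monomial (suc e) g (suc m) = trans (+-identityˡ _) (conv-monomial e g m)

  conv-sh : ∀ e f g → conv f (sh e g) ≈ sh e (conv f g)
  conv-sh e f g m = begin
    conv f (sh e g) m          ≡⟨ conv-congʳ f (sh e g) (conv (δ e) g) (λ k → sym (conv-monomial e g k)) m ⟩
    conv f (conv (δ e) g) m    ≡⟨ sym (conv-assoc f (δ e) g m) ⟩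
    conv (conv f (δ e)) g m    ≡⟨ conv-congˡ (conv f (δ e)) (conv (δ e) f) g (conv-comm f (δ e)) m ⟩
    conv (conv (δ e) f) g m    ≡⟨ conv-assoc (δ e) f g m ⟩
    conv (δ e) (conv f g) m    ≡⟨ conv-monomial e (conv f g) m ⟩
    sh e (conv f g) m          ∎
    where open ≡-Reasoning

  sh-at : ∀ e g m → sh e g (e ℕ.+ m) ≡ g m
  sh-at zero    g m = refl
  sh-at (suc e) g m = sh-at e g m

  sh-below : ∀ e g m → m ℕ.< e → sh e g m ≡ + 0
  sh-below (suc e) g zero    _             = refl
  sh-below (suc e) g (suc m) (ℕ.s≤s m<e) = sh-below e g m m<e

  sh-above : ∀ e g m → e ℕ.≤ m → sh e g m ≡ g (m ∸ e)
  sh-above zero    g m       _             = refl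
  sh-above (suc e) g (suc m) (ℕ.s≤s e≤m) = sh-above e g m e≤m

  sh-∸ : ∀ g → g 0 ≡ + 0 → ∀ e m → sh e g m ≡ g (m ∸ e)
  sh-∸ g g₀ zero    m       = refl
  sh-∸ g g₀ (suc e) zero    = sym g₀
  sh-∸ g g₀ (suc e) (suc m) = sh-∸ g g₀ e m

  sh-from-pieces : ∀ e (f g : Series) → (∀ j → j ℕ.< e → f j ≡ + 0) →
                   (∀ k → f (e ℕ.+ k) ≡ g k) → f ≈ sh e g
  sh-from-pieces zero    f g low high m       = high m
  sh-from-pieces (suc e) f g low high zero    = low 0 (ℕ.s≤s ℕ.z≤n)
  sh-from-pieces (suc e) f g low high (suc m) =
    sh-from-pieces e (tl f) g (λ j j<e → low (suc j) (ℕ.s≤s j<e)) high m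

  sh-injective : ∀ e {f g} → sh e f ≈ sh e g → f ≈ g
  sh-injective e {f} {g} eq m = trans (sym (sh-at e f m)) (trans (eq (e ℕ.+ m)) (sh-at e g m))

  -- A series with constant term 1 is cancellable: this is how a generating
  -- function is identified from the equation it satisfies.
  conv-cancel : ∀ c f g → c 0 ≡ + 1 → conv c f ≈ conv c g → f ≈ g
  conv-cancel c f g c₀ eq m = <-rec (λ m → f m ≡ g m) step m
    where
    d : Series
    d = subS f g

    cd≈0 : ∀ m → conv c d m ≡ + 0
    cd≈0 m = trans (conv-subʳ f g c m)
                   (trans (cong (_- conv c g m) (eq m)) (+-inverseʳ (conv c g m)))

    leading : ∀ m (h : Series) → (∀ j → j ℕ.< m → h j ≡ + 0) → conv h c m ≡ h m * c 0
    leading zero    h _   = +-identityʳ _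
    leading (suc m) h low = begin
      h 0 * c (suc m) + conv (tl h) c m
        ≡⟨ cong₂ _+_ (cong (_* c (suc m)) (low 0 (ℕ.s≤s ℕ.z≤n)))
                     (leading m (tl h) (λ j j<m → low (suc j) (ℕ.s≤s j<m))) ⟩
      + 0 * c (suc m) + h (suc m) * c 0 ≡⟨ +-identityˡ _ ⟩
      h (suc m) * c 0                   ∎
      where open ≡-Reasoning

    step : ∀ m → (∀ {j} → j ℕ.< m → f j ≡ g j) → f m ≡ g m
    step m ih = begin
      f m             ≡⟨ solve 2 (λ x y → x := (x :- y) :+ y) refl (f m) (g m) ⟩
      d m + g m       ≡⟨ cong (_+ g m) dm≡0 ⟩
      + 0 + g m       ≡⟨ +-identityˡ _ ⟩
      g m             ∎
      where
      open ≡-Reasoning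
      dm≡0 : d m ≡ + 0
      dm≡0 = begin
        d m           ≡⟨ sym (*-identityʳ (d m)) ⟩
        d m * + 1     ≡⟨ cong (d m *_) (sym c₀) ⟩
        d m * c 0     ≡⟨ sym (leading m d (λ j j<m → trans (cong (_- g j) (ih j<m)) (+-inverseʳ (g j)))) ⟩
        conv d c m    ≡⟨ conv-comm d c m ⟩
        conv c d m    ≡⟨ cd≈0 m ⟩
        + 0           ∎

  inverse-from-quotient : ∀ A E N D → N 0 ≡ + 1 → conv N A ≈ D → conv D E ≈ N → conv A E ≈ δ 0
  inverse-from-quotient A E N D N₀≡1 NA≈D DE≈N = conv-cancel N (conv A E) (δ 0) N₀≡1 λ m → begin
    conv N (conv A E) m     ≡⟨ sym (conv-assoc N A E m) ⟩
    conv (conv N A) E m     ≡⟨ conv-congˡ (conv N A) D E NA≈D m ⟩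
    conv D E m              ≡⟨ DE≈N m ⟩
    N m                     ≡⟨ sym (conv-identityʳ N m) ⟩
    conv N (δ 0) m          ∎
    where open ≡-Reasoning

  conv-inverse-product : ∀ f f′ g g′ → conv f g ≈ δ 0 → conv f′ g′ ≈ δ 0 →
                         conv (conv f f′) (conv g g′) ≈ δ 0
  conv-inverse-product f f′ g g′ fg≈1 f′g′≈1 m = begin
    conv (conv f f′) (conv g g′) m   ≡⟨ conv-assoc f f′ (conv g g′) m ⟩
    conv f (conv f′ (conv g g′)) m   ≡⟨ conv-congʳ f _ g inner m ⟩
    conv f g m                       ≡⟨ fg≈1 m ⟩
    δ 0 m                            ∎
    where
    open ≡-Reasoning
    inner : conv f′ (conv g g′) ≈ g
    inner k = begin
      conv f′ (conv g g′) k   ≡⟨ conv-comm f′ (conv g g′) k ⟩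
      conv (conv g g′) f′ k   ≡⟨ conv-assoc g g′ f′ k ⟩
      conv g (conv g′ f′) k   ≡⟨ conv-congʳ g _ _ (conv-comm g′ f′) k ⟩
      conv g (conv f′ g′) k   ≡⟨ conv-congʳ g _ _ f′g′≈1 k ⟩
      conv g (δ 0) k          ≡⟨ conv-identityʳ g k ⟩
      g k                     ∎

  sg : ℕ → ℤ
  sg n = (- (+ 1)) ℤ.^ n

  sg-sq : ∀ n → sg n * sg n ≡ + 1
  sg-sq zero    = refl
  sg-sq (suc n) = trans (lem (sg n)) (sg-sq n)
    where
    lem : ∀ x → (- (+ 1) * x) * (- (+ 1) * x) ≡ x * x
    lem = solve 1 (λ x → (:- con (+ 1) :* x) :* (:- con (+ 1) :* x) := x :* x) refl

  sg-suc-neg : ∀ n x → sg (suc n) * (+ 0 - x) ≡ sg n * x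
  sg-suc-neg n x = solve 2 (λ s x → (:- con (+ 1) :* s) :* (con (+ 0) :- x) := s :* x) refl (sg n) x

module Hessenberg where

  open PowerSeries
  open import Data.Nat as ℕ using (ℕ; zero; suc; _∸_; _≤ᵇ_)
  open import Data.Bool using (if_then_else_)
  open import Data.Fin as Fin using (Fin; toℕ; punchIn)
  open import Data.Integer as ℤ using (ℤ; +_; -_; _+_; _*_; _-_)
  open import Data.Integer.Properties
  open import Data.Integer.Solver using (module +-*-Solver)
  open +-*-Solver
  open import Relation.Binary.PropositionalEquality

  det-cong : ∀ n (M N : Fin n → Fin n → ℤ) → (∀ i j → M i j ≡ N i j) → det n M ≡ det n N
  det-cong zero    M N e = refl
  det-cong (suc n) M N e = sumℤ-cong (suc n) _ _ (λ j →
    cong₂ _*_ (cong (sg (toℕ j) *_) (e Fin.zero j))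
              (det-cong n _ _ (λ i k → e (Fin.suc i) (punchIn j k))))

  altDet : Series → Series
  altDet a n = sg n * thDet n a

  module _ (a : Series) (a₀≡1 : a 0 ≡ + 1) where

    entry : ℕ → ℕ → ℤ
    entry i j = if j ≤ᵇ suc i then a (suc i ∸ j) else + 0

    entry-suc : ∀ i j → entry (suc i) (suc j) ≡ entry i j
    entry-suc i zero    = refl
    entry-suc i (suc j) = refl

    bordered : Series → ∀ {n} → Fin n → Fin n → ℤ
    bordered b i Fin.zero    = b (toℕ i)
    bordered b i (Fin.suc j) = entry (toℕ i) (suc (toℕ j))

    Bd : ℕ → Series → ℤ
    Bd n b = det n (bordered b)

    D : ℕ → ℤ
    D n = thDet n a

    D≡Bd : ∀ n → D n ≡ Bd n (tl a)
    D≡Bd n = det-cong n _ _ (λ i → λ { Fin.zero → refl ; (Fin.suc j) → refl })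

    Bd-one : ∀ b → Bd 1 b ≡ b 0
    Bd-one b = lem (b 0)
      where
      lem : ∀ x → (+ 1 * x) * + 1 + + 0 ≡ x
      lem = solve 1 (λ x → (con (+ 1) :* x) :* con (+ 1) :+ con (+ 0) := x) refl

    -- Laplace expansion along the first row, which is (b₀, a₀, 0, …, 0):
    -- Bd_{n+2}(b) = b₀ D_{n+1} - Bd_{n+1}(tl b).
    Bd-expand : ∀ n b → Bd (suc (suc n)) b ≡ b 0 * D (suc n) - Bd (suc n) (tl b)
    Bd-expand n b = begin
      (+ 1 * b 0) * det (suc n) minor₀
        + ((- (+ 1) * + 1 * entry 0 1) * det (suc n) minor₁ + sumℤ n rest)
        ≡⟨ cong₂ (λ x y → (+ 1 * b 0) * x + ((- (+ 1) * + 1 * a 0) * y + sumℤ n rest)) minor₀≡D minor₁≡Bd ⟩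
      (+ 1 * b 0) * D (suc n) + ((- (+ 1) * + 1 * a 0) * Bd (suc n) (tl b) + sumℤ n rest)
        ≡⟨ cong₂ (λ x y → (+ 1 * b 0) * D (suc n) + ((- (+ 1) * + 1 * x) * Bd (suc n) (tl b) + y)) a₀≡1 rest≡0 ⟩
      (+ 1 * b 0) * D (suc n) + ((- (+ 1) * + 1 * + 1) * Bd (suc n) (tl b) + + 0)
        ≡⟨ lem (b 0) (D (suc n)) (Bd (suc n) (tl b)) ⟩
      b 0 * D (suc n) - Bd (suc n) (tl b) ∎
      where
      open ≡-Reasoning
      minor : Fin (suc (suc n)) → Fin (suc n) → Fin (suc n) → ℤ
      minor j i k = bordered b (Fin.suc i) (punchIn j k)
      minor₀ minor₁ : Fin (suc n) → Fin (suc n) → ℤ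
      minor₀ = minor Fin.zero
      minor₁ = minor (Fin.suc Fin.zero)
      rest : Fin n → ℤ
      rest j = (sg (toℕ (Fin.suc (Fin.suc j))) * + 0) * det (suc n) (minor (Fin.suc (Fin.suc j)))

      minor₀≡D : det (suc n) minor₀ ≡ D (suc n)
      minor₀≡D = det-cong (suc n) minor₀ (λ i k → entry (toℕ i) (toℕ k))
                          (λ i k → entry-suc (toℕ i) (toℕ k))
      minor₁≡Bd : det (suc n) minor₁ ≡ Bd (suc n) (tl b)
      minor₁≡Bd = det-cong (suc n) minor₁ (bordered (tl b))
                          (λ i → λ { Fin.zero → refl ; (Fin.suc k) → entry-suc (toℕ i) (suc (toℕ k)) })
      rest≡0 : sumℤ n rest ≡ + 0
      rest≡0 = sumℤ-zero n rest (λ j →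
        trans (cong (_* det (suc n) (minor (Fin.suc (Fin.suc j)))) (*-zeroʳ (sg (suc (suc (toℕ j))))))
              (*-zeroˡ (det (suc n) (minor (Fin.suc (Fin.suc j))))))
      lem : ∀ x y z → (+ 1 * x) * y + ((- (+ 1) * + 1 * + 1) * z + + 0) ≡ x * y - z
      lem = solve 3 (λ x y z → (con (+ 1) :* x) :* y :+ ((:- con (+ 1) :* con (+ 1) :* con (+ 1)) :* z :+ con (+ 0))
                               := x :* y :- z) refl

    Bd-conv : ∀ n b → sg n * Bd (suc n) b ≡ conv b (altDet a) n
    Bd-conv zero b = trans (cong (+ 1 *_) (Bd-one b)) (lem (b 0))
      where
      lem : ∀ x → + 1 * x ≡ x * (+ 1 * + 1) + + 0
      lem = solve 1 (λ x → con (+ 1) :* x := x :* (con (+ 1) :* con (+ 1)) :+ con (+ 0)) refl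
    Bd-conv (suc n) b = begin
      sg (suc n) * Bd (suc (suc n)) b
        ≡⟨ cong (sg (suc n) *_) (Bd-expand n b) ⟩
      (- (+ 1) * sg n) * (b 0 * D (suc n) - Bd (suc n) (tl b))
        ≡⟨ lem (sg n) (b 0) (D (suc n)) (Bd (suc n) (tl b)) ⟩
      b 0 * ((- (+ 1) * sg n) * D (suc n)) + sg n * Bd (suc n) (tl b)
        ≡⟨ cong (_+_ (b 0 * altDet a (suc n))) (Bd-conv n (tl b)) ⟩
      conv b (altDet a) (suc n) ∎
      where
      open ≡-Reasoning
      lem : ∀ s x d f → (- (+ 1) * s) * (x * d - f) ≡ x * ((- (+ 1) * s) * d) + s * f
      lem = solve 4 (λ s x d f → (:- con (+ 1) :* s) :* (x :* d :- f) := x :* ((:- con (+ 1) :* s) :* d) :+ s :* f) refl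

    trudi : conv a (altDet a) ≈ δ 0
    trudi zero    = cong (λ x → x * altDet a 0 + + 0) a₀≡1
    trudi (suc n) = begin
      a 0 * altDet a (suc n) + conv (tl a) (altDet a) n
        ≡⟨ cong₂ (λ x y → x * ((- (+ 1) * sg n) * y) + conv (tl a) (altDet a) n) a₀≡1 (D≡Bd (suc n)) ⟩
      + 1 * ((- (+ 1) * sg n) * Bd (suc n) (tl a)) + conv (tl a) (altDet a) n
        ≡⟨ cong (_+_ (+ 1 * ((- (+ 1) * sg n) * Bd (suc n) (tl a)))) (sym (Bd-conv n (tl a))) ⟩
      + 1 * ((- (+ 1) * sg n) * Bd (suc n) (tl a)) + sg n * Bd (suc n) (tl a)
        ≡⟨ lem (sg n) (Bd (suc n) (tl a)) ⟩
      + 0 ∎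
      where
      open ≡-Reasoning
      lem : ∀ s f → + 1 * ((- (+ 1) * s) * f) + s * f ≡ + 0
      lem = solve 2 (λ s f → con (+ 1) :* ((:- con (+ 1) :* s) :* f) :+ s :* f := con (+ 0)) refl

  det-from-inverse : ∀ (a E : Series) → a 0 ≡ + 1 → conv a E ≈ δ 0 →
                     ∀ n → thDet n a ≡ sg n * E n
  det-from-inverse a E a₀≡1 aE≈1 n = begin
    thDet n a                     ≡⟨ sym (*-identityˡ _) ⟩
    + 1 * thDet n a               ≡⟨ cong (_* thDet n a) (sym (sg-sq n)) ⟩
    (sg n * sg n) * thDet n a     ≡⟨ *-assoc (sg n) (sg n) (thDet n a) ⟩
    sg n * altDet a n             ≡⟨ cong (sg n *_) (sym (E≈altDet n)) ⟩
    sg n * E n                    ∎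
    where
    open ≡-Reasoning
    E≈altDet : E ≈ altDet a
    E≈altDet = conv-cancel a E (altDet a) a₀≡1 (λ m → trans (aE≈1 m) (sym (trudi a a₀≡1 m)))

-- Even and odd parts.  spread c = c(x²); bisecting a product with an
-- even series: (c(x²)·t)_{2m+ε} = (c · t_{ε+2·})_m.
module Bisection where

  open PowerSeries
  open import Data.Nat as ℕ using (ℕ; zero; suc)
  open import Data.Nat.Properties using (+-suc)
  open import Data.Integer using (+_; _+_; _*_)
  open import Data.Integer.Properties using (*-zeroˡ; *-zeroʳ; +-identityˡ)
  open import Relation.Binary.PropositionalEquality

  dbl : ℕ → ℕ
  dbl zero    = zero
  dbl (suc n) = suc (suc (dbl n))

  dbl-+ : ∀ n → dbl n ≡ n ℕ.+ n
  dbl-+ zero    = refl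
  dbl-+ (suc n) = cong suc (trans (cong suc (dbl-+ n)) (sym (+-suc n n)))

  spread : Series → Series
  spread c zero          = c 0
  spread c (suc zero)    = + 0
  spread c (suc (suc m)) = spread (tl c) m

  private
    zero-term : ∀ x y → + 0 * x + y ≡ y
    zero-term x y = trans (cong (_+ y) (*-zeroˡ x)) (+-identityˡ y)

  bisect-even : ∀ m c (t : Series) → conv (spread c) t (dbl m) ≡ conv c (λ k → t (dbl k)) m
  bisect-even zero    c t = refl
  bisect-even (suc m) c t = cong (_+_ (c 0 * t (dbl (suc m))))
    (trans (zero-term (t (suc (dbl m))) _) (bisect-even m (tl c) t))

  bisect-odd : ∀ m c (t : Series) → conv (spread c) t (suc (dbl m)) ≡ conv c (λ k → t (suc (dbl k))) m
  bisect-odd zero    c t = cong (_+_ (c 0 * t 1)) (zero-term (t 0) (+ 0))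
  bisect-odd (suc m) c t = cong (_+_ (c 0 * t (suc (dbl (suc m)))))
    (trans (zero-term (t (suc (suc (dbl m)))) _) (bisect-odd m (tl c) t))

  spread-zero : ∀ m → spread zeroS m ≡ + 0
  spread-zero zero          = refl
  spread-zero (suc zero)    = refl
  spread-zero (suc (suc m)) = spread-zero m

  spread-δ : ∀ n m → spread (δ n) m ≡ δ (dbl n) m
  spread-δ zero    zero          = refl
  spread-δ (suc n) zero          = refl
  spread-δ zero    (suc zero)    = refl
  spread-δ (suc n) (suc zero)    = refl
  spread-δ zero    (suc (suc m)) = spread-zero m
  spread-δ (suc n) (suc (suc m)) = spread-δ n m

  spread-linear : ∀ c (f g : Series) m → spread (λ k → c * f k + g k) m ≡ c * spread f m + spread g m
  spread-linear c f g zero          = refl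
  spread-linear c f g (suc zero)    = sym (cong (_+ + 0) (*-zeroʳ c))
  spread-linear c f g (suc (suc m)) = spread-linear c (tl f) (tl g) m

  spread-even : ∀ c m → spread c (dbl m) ≡ c m
  spread-even c zero    = refl
  spread-even c (suc m) = spread-even (tl c) m

  spread-odd : ∀ c m → spread c (suc (dbl m)) ≡ + 0
  spread-odd c zero    = refl
  spread-odd c (suc m) = spread-odd (tl c) m

-- Polynomials whose exponents have the form a + b·B for a fixed B, stored as
-- lists of (coefficient, (a , b)).  A normal form (sorted, merged, without
-- zero terms) lets Agda check identities between such polynomials by
-- computation, uniformly in B; evalP turns them into power series.
module SymbolicPolynomial (B : ℕ) where

  open PowerSeries
  open Bisection
  open import Data.Nat as ℕ using (ℕ; zero; suc)
  import Data.Nat.Properties as ℕP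
  import Data.Nat.Solver
  module ℕS = Data.Nat.Solver.+-*-Solver
  open import Data.Product using (_×_; _,_)
  open import Data.List using (List; []; _∷_; _++_; map)
  open import Data.Integer as ℤ using (ℤ; +_; -_; _+_; _*_; _-_)
  open import Data.Integer.Properties
  open import Data.Integer.Solver using (module +-*-Solver)
  open +-*-Solver
  open import Relation.Binary.PropositionalEquality
  open import Relation.Nullary using (yes; no)

  -- b·B, defined so that 1·B is B on the nose
  times : ℕ → ℕ
  times zero          = 0
  times (suc zero)    = B
  times (suc (suc b)) = B ℕ.+ times (suc b)

  times-suc : ∀ b → times (suc b) ≡ B ℕ.+ times b
  times-suc zero    = sym (ℕP.+-identityʳ B)
  times-suc (suc b) = refl

  times-+ : ∀ b b′ → times (b ℕ.+ b′) ≡ times b ℕ.+ times b′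
  times-+ zero    b′ = refl
  times-+ (suc b) b′ = begin
    times (suc (b ℕ.+ b′))          ≡⟨ times-suc (b ℕ.+ b′) ⟩
    B ℕ.+ times (b ℕ.+ b′)          ≡⟨ cong (B ℕ.+_) (times-+ b b′) ⟩
    B ℕ.+ (times b ℕ.+ times b′)    ≡⟨ sym (ℕP.+-assoc B _ _) ⟩
    (B ℕ.+ times b) ℕ.+ times b′    ≡⟨ cong (ℕ._+ times b′) (sym (times-suc b)) ⟩
    times (suc b) ℕ.+ times b′      ∎
    where open ≡-Reasoning

  Exp : Set
  Exp = ℕ × ℕ

  val : Exp → ℕ
  val (a , b) = a ℕ.+ times b

  _⊕_ : Exp → Exp → Exp
  (a , b) ⊕ (a′ , b′) = (a ℕ.+ a′ , b ℕ.+ b′)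

  val-⊕ : ∀ e e′ → val e ℕ.+ val e′ ≡ val (e ⊕ e′)
  val-⊕ (a , b) (a′ , b′) = begin
    (a ℕ.+ times b) ℕ.+ (a′ ℕ.+ times b′)
      ≡⟨ ℕS.solve 4 (λ a b a′ b′ → (a ℕS.:+ b) ℕS.:+ (a′ ℕS.:+ b′) ℕS.:= (a ℕS.:+ a′) ℕS.:+ (b ℕS.:+ b′))
                    refl a (times b) a′ (times b′) ⟩
    (a ℕ.+ a′) ℕ.+ (times b ℕ.+ times b′) ≡⟨ cong ((a ℕ.+ a′) ℕ.+_) (sym (times-+ b b′)) ⟩
    (a ℕ.+ a′) ℕ.+ times (b ℕ.+ b′)       ∎
    where open ≡-Reasoning

  val-dbl : ∀ a b → val (a ℕ.+ a , b ℕ.+ b) ≡ dbl (val (a , b))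
  val-dbl a b = begin
    (a ℕ.+ a) ℕ.+ times (b ℕ.+ b)          ≡⟨ cong ((a ℕ.+ a) ℕ.+_) (times-+ b b) ⟩
    (a ℕ.+ a) ℕ.+ (times b ℕ.+ times b)
      ≡⟨ ℕS.solve 2 (λ a b → (a ℕS.:+ a) ℕS.:+ (b ℕS.:+ b) ℕS.:= (a ℕS.:+ b) ℕS.:+ (a ℕS.:+ b)) refl a (times b) ⟩
    (a ℕ.+ times b) ℕ.+ (a ℕ.+ times b)    ≡⟨ sym (dbl-+ (a ℕ.+ times b)) ⟩
    dbl (a ℕ.+ times b)                    ∎
    where open ≡-Reasoning

  Poly : Set
  Poly = List (ℤ × Exp)

  evalP : Poly → Series
  evalP []            m = + 0
  evalP ((c , e) ∷ p) m = c * δ (val e) m + evalP p m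

  evalP-++ : ∀ p q m → evalP (p ++ q) m ≡ evalP p m + evalP q m
  evalP-++ []            q m = sym (+-identityˡ _)
  evalP-++ ((c , e) ∷ p) q m =
    trans (cong (_+_ (c * δ (val e) m)) (evalP-++ p q m))
          (sym (+-assoc (c * δ (val e) m) (evalP p m) (evalP q m)))

  negP : Poly → Poly
  negP = map (λ { (c , e) → (- c , e) })

  evalP-neg : ∀ p m → evalP (negP p) m ≡ - evalP p m
  evalP-neg []            m = refl
  evalP-neg ((c , e) ∷ p) m =
    trans (cong (_+_ (- c * δ (val e) m)) (evalP-neg p m)) (lem c (δ (val e) m) (evalP p m))
    where
    lem : ∀ c d x → - c * d + - x ≡ - (c * d + x)
    lem = solve 3 (λ c d x → (:- c) :* d :+ (:- x) := :- (c :* d :+ x)) refl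

  evalP-sub : ∀ p q m → evalP p m - evalP q m ≡ evalP (p ++ negP q) m
  evalP-sub p q m = trans (cong (_+_ (evalP p m)) (sym (evalP-neg q m))) (sym (evalP-++ p (negP q) m))

  shiftP : Exp → Poly → Poly
  shiftP e = map (λ { (c , e′) → (c , e ⊕ e′) })

  scalP : ℤ → Poly → Poly
  scalP k = map (λ { (c , e) → (k * c , e) })

  private
    shTerms : ℕ → Poly → Series
    shTerms n []            m = + 0
    shTerms n ((c , e) ∷ p) m = c * δ (n ℕ.+ val e) m + shTerms n p m

    sh-evalP-terms : ∀ n p m → sh n (evalP p) m ≡ shTerms n p m
    sh-evalP-terms zero p m = go p
      where
      go : ∀ p → evalP p m ≡ shTerms 0 p m
      go []            = refl
      go ((c , e) ∷ p) = cong (_+_ (c * δ (val e) m)) (go p)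
    sh-evalP-terms (suc n) p zero = sym (go p)
      where
      go : ∀ p → shTerms (suc n) p 0 ≡ + 0
      go []            = refl
      go ((c , e) ∷ p) = cong₂ _+_ (*-zeroʳ c) (go p)
    sh-evalP-terms (suc n) p (suc m) = trans (sh-evalP-terms n p m) (go p)
      where
      go : ∀ p → shTerms n p m ≡ shTerms (suc n) p (suc m)
      go []            = refl
      go ((c , e) ∷ p) = cong (_+_ (c * δ (n ℕ.+ val e) m)) (go p)

  sh-evalP : ∀ e p m → sh (val e) (evalP p) m ≡ evalP (shiftP e p) m
  sh-evalP e p m = trans (sh-evalP-terms (val e) p m) (go p)
    where
    go : ∀ p → shTerms (val e) p m ≡ evalP (shiftP e p) m
    go []             = refl
    go ((c , e′) ∷ p) = cong₂ _+_ (cong (λ z → c * δ z m) (val-⊕ e e′)) (go p)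

  evalP-scal : ∀ k p m → k * evalP p m ≡ evalP (scalP k p) m
  evalP-scal k []            m = *-zeroʳ k
  evalP-scal k ((c , e) ∷ p) m =
    trans (lem k c (δ (val e) m) (evalP p m)) (cong (_+_ ((k * c) * δ (val e) m)) (evalP-scal k p m))
    where
    lem : ∀ k c d x → k * (c * d + x) ≡ (k * c) * d + k * x
    lem = solve 4 (λ k c d x → k :* (c :* d :+ x) := (k :* c) :* d :+ k :* x) refl

  shifts : Poly → Series → Series
  shifts []            g m = + 0
  shifts ((c , e) ∷ p) g m = c * sh (val e) g m + shifts p g m

  conv-evalP-shifts : ∀ p g → conv (evalP p) g ≈ shifts p g
  conv-evalP-shifts []            g m = conv-zeroˡ g m
  conv-evalP-shifts ((c , e) ∷ p) g m = begin
    conv (evalP ((c , e) ∷ p)) g m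
      ≡⟨ conv-addˡ (scal c (δ (val e))) (evalP p) g m ⟩
    conv (scal c (δ (val e))) g m + conv (evalP p) g m
      ≡⟨ cong₂ _+_ (trans (conv-scalˡ c (δ (val e)) g m) (cong (c *_) (conv-monomial (val e) g m)))
                   (conv-evalP-shifts p g m) ⟩
    shifts ((c , e) ∷ p) g m ∎
    where open ≡-Reasoning

  _⊗_ : Poly → Poly → Poly
  []            ⊗ q = []
  ((c , e) ∷ p) ⊗ q = scalP c (shiftP e q) ++ (p ⊗ q)

  conv-evalP : ∀ p q → conv (evalP p) (evalP q) ≈ evalP (p ⊗ q)
  conv-evalP p q m = trans (conv-evalP-shifts p (evalP q) m) (go p)
    where
    go : ∀ p → shifts p (evalP q) m ≡ evalP (p ⊗ q) m
    go []            = refl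
    go ((c , e) ∷ p) = begin
      c * sh (val e) (evalP q) m + shifts p (evalP q) m
        ≡⟨ cong₂ _+_ (trans (cong (c *_) (sh-evalP e q m)) (evalP-scal c (shiftP e q) m)) (go p) ⟩
      evalP (scalP c (shiftP e q)) m + evalP (p ⊗ q) m
        ≡⟨ sym (evalP-++ (scalP c (shiftP e q)) (p ⊗ q) m) ⟩
      evalP (((c , e) ∷ p) ⊗ q) m ∎
      where open ≡-Reasoning

  dblP : Poly → Poly
  dblP = map (λ { (c , (a , b)) → (c , (a ℕ.+ a , b ℕ.+ b)) })

  spread-evalP : ∀ q → spread (evalP q) ≈ evalP (dblP q)
  spread-evalP []                  m = spread-zero m
  spread-evalP ((c , (a , b)) ∷ q) m = begin
    spread (evalP ((c , (a , b)) ∷ q)) m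
      ≡⟨ spread-linear c (δ (val (a , b))) (evalP q) m ⟩
    c * spread (δ (val (a , b))) m + spread (evalP q) m
      ≡⟨ cong₂ _+_ (cong (c *_) (trans (spread-δ (val (a , b)) m) (cong (λ z → δ z m) (sym (val-dbl a b)))))
                   (spread-evalP q m) ⟩
    evalP (dblP ((c , (a , b)) ∷ q)) m ∎
    where open ≡-Reasoning

  data Order (e e′ : Exp) : Set where
    lt : Order e e′
    eq : e ≡ e′ → Order e e′
    gt : Order e e′

  compareExp : (e e′ : Exp) → Order e e′
  compareExp (a , b) (a′ , b′) with ℕ.compare a a′
  ... | ℕ.less _ _    = lt
  ... | ℕ.greater _ _ = gt
  ... | ℕ.equal _ with ℕ.compare b b′
  ...   | ℕ.less _ _    = lt
  ...   | ℕ.greater _ _ = gt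
  ...   | ℕ.equal _     = eq refl

  insert : ℤ × Exp → Poly → Poly
  insert x [] = x ∷ []
  insert (c , e) ((c′ , e′) ∷ p) with compareExp e e′
  ... | lt   = (c , e) ∷ (c′ , e′) ∷ p
  ... | eq _ = (c + c′ , e′) ∷ p
  ... | gt   = (c′ , e′) ∷ insert (c , e) p

  evalP-insert : ∀ c e p m → evalP (insert (c , e) p) m ≡ c * δ (val e) m + evalP p m
  evalP-insert c e []              m = refl
  evalP-insert c e ((c′ , e′) ∷ p) m with compareExp e e′
  ... | lt      = refl
  ... | eq refl = lem c c′ (δ (val e) m) (evalP p m)
    where
    lem : ∀ c c′ d x → (c + c′) * d + x ≡ c * d + (c′ * d + x)
    lem = solve 4 (λ c c′ d x → (c :+ c′) :* d :+ x := c :* d :+ (c′ :* d :+ x)) refl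
  ... | gt      = trans (cong (_+_ (c′ * δ (val e′) m)) (evalP-insert c e p m))
                        (lem c c′ (δ (val e) m) (δ (val e′) m) (evalP p m))
    where
    lem : ∀ c c′ d d′ x → c′ * d′ + (c * d + x) ≡ c * d + (c′ * d′ + x)
    lem = solve 5 (λ c c′ d d′ x → c′ :* d′ :+ (c :* d :+ x) := c :* d :+ (c′ :* d′ :+ x)) refl

  sortP : Poly → Poly
  sortP []      = []
  sortP (x ∷ p) = insert x (sortP p)

  evalP-sortP : ∀ p m → evalP (sortP p) m ≡ evalP p m
  evalP-sortP []            m = refl
  evalP-sortP ((c , e) ∷ p) m =
    trans (evalP-insert c e (sortP p) m) (cong (_+_ (c * δ (val e) m)) (evalP-sortP p m))

  dropZeros : Poly → Poly
  dropZeros [] = []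
  dropZeros ((c , e) ∷ p) with c ℤ.≟ + 0
  ... | yes _ = dropZeros p
  ... | no _  = (c , e) ∷ dropZeros p

  evalP-dropZeros : ∀ p m → evalP (dropZeros p) m ≡ evalP p m
  evalP-dropZeros []            m = refl
  evalP-dropZeros ((c , e) ∷ p) m with c ℤ.≟ + 0
  ... | yes refl = trans (evalP-dropZeros p m) (sym (+-identityˡ _))
  ... | no _     = cong (_+_ (c * δ (val e) m)) (evalP-dropZeros p m)

  normalP : Poly → Poly
  normalP p = dropZeros (sortP p)

  evalP-normalP : ∀ p m → evalP (normalP p) m ≡ evalP p m
  evalP-normalP p m = trans (evalP-dropZeros (sortP p) m) (evalP-sortP p m)

  -- Polynomials with equal normal forms are equal as series; in use the
  -- hypothesis is discharged by refl.
  polyEq : ∀ p q → normalP p ≡ normalP q → evalP p ≈ evalP q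
  polyEq p q e m =
    trans (sym (evalP-normalP p m)) (trans (cong (λ z → evalP z m) e) (evalP-normalP q m))

  split : Poly → Poly → Poly
  split p₀ p₁ = dblP p₀ ++ shiftP (1 , 0) (dblP p₁)

  split-even : ∀ p₀ p₁ m → evalP (split p₀ p₁) (dbl m) ≡ evalP p₀ m
  split-even p₀ p₁ m = begin
    evalP (split p₀ p₁) (dbl m)
      ≡⟨ evalP-++ (dblP p₀) (shiftP (1 , 0) (dblP p₁)) (dbl m) ⟩
    evalP (dblP p₀) (dbl m) + evalP (shiftP (1 , 0) (dblP p₁)) (dbl m)
      ≡⟨ cong₂ _+_ (trans (sym (spread-evalP p₀ (dbl m))) (spread-even (evalP p₀) m))
                   (trans (sym (sh-evalP (1 , 0) (dblP p₁) (dbl m))) (odd-vanishes m)) ⟩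
    evalP p₀ m + + 0 ≡⟨ +-identityʳ _ ⟩
    evalP p₀ m ∎
    where
    open ≡-Reasoning
    odd-vanishes : ∀ m → sh 1 (evalP (dblP p₁)) (dbl m) ≡ + 0
    odd-vanishes zero    = refl
    odd-vanishes (suc m) = trans (sym (spread-evalP p₁ (suc (dbl m)))) (spread-odd (evalP p₁) m)

  split-odd : ∀ p₀ p₁ m → evalP (split p₀ p₁) (suc (dbl m)) ≡ evalP p₁ m
  split-odd p₀ p₁ m = begin
    evalP (split p₀ p₁) (suc (dbl m))
      ≡⟨ evalP-++ (dblP p₀) (shiftP (1 , 0) (dblP p₁)) (suc (dbl m)) ⟩
    evalP (dblP p₀) (suc (dbl m)) + evalP (shiftP (1 , 0) (dblP p₁)) (suc (dbl m))
      ≡⟨ cong₂ _+_ (trans (sym (spread-evalP p₀ (suc (dbl m)))) (spread-odd (evalP p₀) m))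
                   (trans (sym (sh-evalP (1 , 0) (dblP p₁) (suc (dbl m))))
                          (trans (sym (spread-evalP p₁ (dbl m))) (spread-even (evalP p₁) m))) ⟩
    + 0 + evalP p₁ m ≡⟨ +-identityˡ _ ⟩
    evalP p₁ m ∎
    where open ≡-Reasoning

  module Bisect (t : Series) (M D N Q′ p₀ p₁ : Poly) (Dt≈N : conv (evalP D) t ≈ evalP N)
                (MD≡Q′² : normalP (M ⊗ D) ≡ normalP (dblP Q′))
                (MN≡split : normalP (M ⊗ N) ≡ normalP (split p₀ p₁)) where

    Q′²t≈MN : ∀ m → conv (spread (evalP Q′)) t m ≡ evalP (split p₀ p₁) m
    Q′²t≈MN m = begin
      conv (spread (evalP Q′)) t m         ≡⟨ conv-congˡ _ _ t (λ k → trans (spread-evalP Q′ k)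
                                                  (trans (polyEq (dblP Q′) (M ⊗ D) (sym MD≡Q′²) k)
                                                         (sym (conv-evalP M D k)))) m ⟩
      conv (conv (evalP M) (evalP D)) t m  ≡⟨ conv-assoc (evalP M) (evalP D) t m ⟩
      conv (evalP M) (conv (evalP D) t) m  ≡⟨ conv-congʳ (evalP M) _ _ Dt≈N m ⟩
      conv (evalP M) (evalP N) m           ≡⟨ conv-evalP M N m ⟩
      evalP (M ⊗ N) m                      ≡⟨ polyEq (M ⊗ N) (split p₀ p₁) MN≡split m ⟩
      evalP (split p₀ p₁) m                ∎
      where open ≡-Reasoning

    even-part : conv (evalP Q′) (λ k → t (dbl k)) ≈ evalP p₀
    even-part m = trans (sym (bisect-even m (evalP Q′) t)) (trans (Q′²t≈MN (dbl m)) (split-even p₀ p₁ m))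

    odd-part : conv (evalP Q′) (λ k → t (suc (dbl k))) ≈ evalP p₁
    odd-part m = trans (sym (bisect-odd m (evalP Q′) t)) (trans (Q′²t≈MN (suc (dbl m))) (split-odd p₀ p₁ m))

module Recurrences where

  open PowerSeries
  open Bisection using (dbl; dbl-+)
  open import Data.Nat as ℕ using (ℕ; zero; suc; _∸_; _<ᵇ_; _≡ᵇ_; _<_; _≤_; z≤n; s≤s)
  import Data.Nat.Properties as ℕP
  open ℕP using (m∸n≤m; ≤-<-trans)
  import Data.Nat.Solver
  module ℕS = Data.Nat.Solver.+-*-Solver
  open import Data.Bool using (true; false; if_then_else_; T)
  open import Data.Empty using (⊥-elim)
  open import Data.Integer using (+_; _-_)
  open import Data.Integer.Properties using (pos-+; +-identityʳ)
  open import Data.Integer.Solver using (module +-*-Solver)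
  open +-*-Solver
  open import Relation.Nullary using (¬_; yes; no)
  open import Relation.Binary.Definitions using (tri<; tri≈; tri>)
  open import Relation.Binary.PropositionalEquality

  if-true : ∀ {A : Set} b {x y : A} → T b → (if b then x else y) ≡ x
  if-true true _ = refl

  if-false : ∀ {A : Set} b {x y : A} → ¬ T b → (if b then x else y) ≡ y
  if-false true  ¬b = ⊥-elim (¬b _)
  if-false false _  = refl

  δ-≢ : ∀ e m → e ≢ m → δ e m ≡ + 0
  δ-≢ e m e≢m = if-false (e ≡ᵇ m) (λ b → e≢m (ℕP.≡ᵇ⇒≡ e m b))

  δ-same : ∀ e → δ e e ≡ + 1
  δ-same e = if-true (e ≡ᵇ e) (ℕP.≡⇒≡ᵇ e e refl)

  module Tribonacci (q : ℕ) where

    r : ℕ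
    r = suc (suc (suc q))

    fuel : ∀ f g n → n < f → n < g → tribGo r f n ≡ tribGo r g n
    fuel (suc f) (suc g) zero    _         _         = refl
    fuel (suc f) (suc g) (suc n) (s≤s n<f) (s≤s n<g) =
      cong (λ z → if suc n <ᵇ suc (suc q) then 0 else if suc n ≡ᵇ suc (suc q) then 1 else z)
        (cong₂ ℕ._+_ (cong₂ ℕ._+_ (fuel f g n n<f n<g) (fuel f g (n ∸ 1) (below 1 n<f) (below 1 n<g)))
                     (fuel f g (n ∸ suc (suc q)) (below (suc (suc q)) n<f) (below (suc (suc q)) n<g)))
      where
      below : ∀ {n f} k → n < f → n ∸ k < f
      below {n} k n<f = ≤-<-trans (m∸n≤m n k) n<f

    t : Series
    t m = + tribR r m

    t-initial : ∀ n → n < suc (suc q) → tribR r n ≡ 0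
    t-initial n n<r-1 = if-true (n <ᵇ suc (suc q)) (ℕP.<⇒<ᵇ n<r-1)

    t-one : tribR r (suc (suc q)) ≡ 1
    t-one = trans (if-false (suc (suc q) <ᵇ suc (suc q))
                            (λ b → ℕP.<-irrefl refl (ℕP.<ᵇ⇒< (suc (suc q)) (suc (suc q)) b)))
                  (if-true (suc (suc q) ≡ᵇ suc (suc q)) (ℕP.≡⇒≡ᵇ (suc (suc q)) (suc (suc q)) refl))

    t-step : ∀ n → r ≤ suc n →
             tribR r (suc n) ≡ (tribR r n ℕ.+ tribR r (n ∸ 1)) ℕ.+ tribR r (n ∸ suc (suc q))
    t-step n r≤n+1 = begin
      tribR r (suc n)
        ≡⟨ if-false (suc n <ᵇ suc (suc q)) (λ b → ℕP.<-asym (ℕP.<ᵇ⇒< (suc n) (suc (suc q)) b) r≤n+1) ⟩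
      (if suc n ≡ᵇ suc (suc q) then 1
       else (tribGo r (suc n) n ℕ.+ tribGo r (suc n) (n ∸ 1)) ℕ.+ tribGo r (suc n) (n ∸ suc (suc q)))
        ≡⟨ if-false (suc n ≡ᵇ suc (suc q)) (λ b → ℕP.<-irrefl (sym (ℕP.≡ᵇ⇒≡ (suc n) (suc (suc q)) b)) r≤n+1) ⟩
      (tribGo r (suc n) n ℕ.+ tribGo r (suc n) (n ∸ 1)) ℕ.+ tribGo r (suc n) (n ∸ suc (suc q))
        ≡⟨ cong₂ ℕ._+_ (cong (tribR r n ℕ.+_) (fuel (suc n) (suc (n ∸ 1)) (n ∸ 1) (s≤s (m∸n≤m n 1)) ℕP.≤-refl))
                       (fuel (suc n) (suc (n ∸ suc (suc q))) (n ∸ suc (suc q)) (s≤s (m∸n≤m n (suc (suc q)))) ℕP.≤-refl) ⟩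
      (tribR r n ℕ.+ tribR r (n ∸ 1)) ℕ.+ tribR r (n ∸ suc (suc q)) ∎
      where open ≡-Reasoning

    t-zero : t 0 ≡ + 0
    t-zero = cong +_ (t-initial 0 (s≤s z≤n))

    t-recurrence : ∀ m → ((t m - sh 1 t m) - sh 2 t m) - sh r t m ≡ δ (suc (suc q)) m
    t-recurrence m rewrite sh-∸ t t-zero 1 m | sh-∸ t t-zero 2 m | sh-∸ t t-zero r m
      with ℕP.<-cmp m (suc (suc q))
    ... | tri< m<r-1 _ _ = begin
      ((t m - t (m ∸ 1)) - t (m ∸ 2)) - t (m ∸ r)
        ≡⟨ cong₂ _-_ (cong₂ _-_ (cong₂ _-_ (vanish m m<r-1) (vanish (m ∸ 1) (below 1)))
                                (vanish (m ∸ 2) (below 2))) (vanish (m ∸ r) (below r)) ⟩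
      + 0                   ≡⟨ sym (δ-≢ _ m (λ e → ℕP.<-irrefl (sym e) m<r-1)) ⟩
      δ (suc (suc q)) m     ∎
      where
      open ≡-Reasoning
      vanish : ∀ n → n < suc (suc q) → t n ≡ + 0
      vanish n n<r-1 = cong +_ (t-initial n n<r-1)
      below : ∀ k → m ∸ k < suc (suc q)
      below k = ≤-<-trans (m∸n≤m m k) m<r-1
    ... | tri≈ _ refl _ = begin
      ((t (suc (suc q)) - t (suc q)) - t q) - t (suc (suc q) ∸ r)
        ≡⟨ cong₂ _-_ (cong₂ _-_ (cong₂ _-_ (cong +_ t-one) (cong +_ (t-initial (suc q) (ℕP.n<1+n (suc q)))))
                                (cong +_ (t-initial q (ℕP.≤-trans (ℕP.n<1+n q) (ℕP.n≤1+n (suc q))))))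
                     (trans (cong t (ℕP.m≤n⇒m∸n≡0 {suc (suc q)} {r} (ℕP.n≤1+n (suc (suc q))))) t-zero) ⟩
      + 1                                   ≡⟨ sym (δ-same (suc (suc q))) ⟩
      δ (suc (suc q)) (suc (suc q))         ∎
      where open ≡-Reasoning
    ... | tri> _ _ r-1<m = trans (beyond m r-1<m) (sym (δ-≢ _ m (λ e → ℕP.<-irrefl e r-1<m)))
      where
      beyond : ∀ m → suc (suc q) < m → ((t m - t (m ∸ 1)) - t (m ∸ 2)) - t (m ∸ r) ≡ + 0
      beyond (suc n) r≤n+1 =
        trans (cong (λ x → ((+ x - + tribR r n) - + tribR r (n ∸ 1)) - + tribR r (n ∸ suc (suc q)))
                    (t-step n r≤n+1))
              (lem (tribR r n) (tribR r (n ∸ 1)) (tribR r (n ∸ suc (suc q))))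
        where
        lem : ∀ a b c → ((+ ((a ℕ.+ b) ℕ.+ c) - + a) - + b) - + c ≡ + 0
        lem a b c rewrite pos-+ (a ℕ.+ b) c | pos-+ a b =
          solve 3 (λ a b c → ((a :+ b :+ c) :- a :- b) :- c := con (+ 0)) refl (+ a) (+ b) (+ c)

    entries′ : Series
    entries′ = subS (tribEntries r) (δ 0)

    -- If r = ε + 2p + 2, the terms t_{ε+2j} are x^p · entries′: they vanish
    -- for j ≤ p (below the first 1 at index r - 1), and t_{ε+2(p+k)} = T_{r+2k-2}.
    bisected-entries : ∀ ε p → ε ℕ.+ dbl p ≡ suc q → (λ j → t (ε ℕ.+ dbl j)) ≈ sh p entries′
    bisected-entries ε p r-2≡ = sh-from-pieces p _ entries′ (λ j j<p → small j (ℕP.<⇒≤ j<p)) large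
      where
      small : ∀ j → j ≤ p → t (ε ℕ.+ dbl j) ≡ + 0
      small j j≤p = cong +_ (t-initial (ε ℕ.+ dbl j) (s≤s (begin
        ε ℕ.+ dbl j   ≤⟨ ℕP.+-monoʳ-≤ ε (dbl-mono j≤p) ⟩
        ε ℕ.+ dbl p   ≡⟨ r-2≡ ⟩
        suc q         ∎)))
        where
        open ℕP.≤-Reasoning
        dbl-mono : ∀ {i j} → i ≤ j → dbl i ≤ dbl j
        dbl-mono z≤n       = z≤n
        dbl-mono (s≤s i≤j) = s≤s (s≤s (dbl-mono i≤j))
      index : ∀ k → ε ℕ.+ dbl (p ℕ.+ suc k) ≡ r ℕ.+ 2 ℕ.* k
      index k = begin
        ε ℕ.+ dbl (p ℕ.+ suc k)
          ≡⟨ cong (ε ℕ.+_) (dbl-+ (p ℕ.+ suc k)) ⟩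
        ε ℕ.+ ((p ℕ.+ suc k) ℕ.+ (p ℕ.+ suc k))
          ≡⟨ ℕS.solve 3 (λ ε p k → ε ℕS.:+ ((p ℕS.:+ (ℕS.con 1 ℕS.:+ k)) ℕS.:+ (p ℕS.:+ (ℕS.con 1 ℕS.:+ k)))
                                  ℕS.:= ℕS.con 2 ℕS.:+ (ε ℕS.:+ (p ℕS.:+ p)) ℕS.:+ ℕS.con 2 ℕS.:* k) refl ε p k ⟩
        suc (suc (ε ℕ.+ (p ℕ.+ p))) ℕ.+ 2 ℕ.* k
          ≡⟨ cong (λ z → suc (suc (ε ℕ.+ z)) ℕ.+ 2 ℕ.* k) (sym (dbl-+ p)) ⟩
        suc (suc (ε ℕ.+ dbl p)) ℕ.+ 2 ℕ.* k
          ≡⟨ cong (λ z → suc (suc z) ℕ.+ 2 ℕ.* k) r-2≡ ⟩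
        r ℕ.+ 2 ℕ.* k ∎
        where open ≡-Reasoning
      large : ∀ k → t (ε ℕ.+ dbl (p ℕ.+ k)) ≡ entries′ k
      large zero    = trans (cong (λ z → t (ε ℕ.+ dbl z)) (ℕP.+-identityʳ p)) (small p ℕP.≤-refl)
      large (suc k) = trans (cong (λ z → + tribR r z) (index k)) (sym (+-identityʳ _))

  module ASeq (p : ℕ) where

    s : ℕ
    s = suc (suc p)

    fuel : ∀ f g n → n < f → n < g → aGo s f n ≡ aGo s g n
    fuel (suc f) (suc g) zero    _         _         = refl
    fuel (suc f) (suc g) (suc n) (s≤s n<f) (s≤s n<g) =
      cong (λ z → if suc n <ᵇ s then 1 else z)
        (cong₂ ℕ._+_ (fuel f g n n<f n<g)
                     (fuel f g (n ∸ suc p) (≤-<-trans (m∸n≤m n (suc p)) n<f) (≤-<-trans (m∸n≤m n (suc p)) n<g)))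

    A : Series
    A m = + aSeq s m

    A-initial : ∀ n → n < s → aSeq s n ≡ 1
    A-initial n n<s = if-true (n <ᵇ s) (ℕP.<⇒<ᵇ n<s)

    A-step : ∀ n → s ≤ suc n → aSeq s (suc n) ≡ aSeq s n ℕ.+ aSeq s (suc n ∸ s)
    A-step n s≤n+1 =
      trans (if-false (suc n <ᵇ s) (λ b → ℕP.<-irrefl refl (ℕP.<-≤-trans (ℕP.<ᵇ⇒< (suc n) s b) s≤n+1)))
            (cong (aSeq s n ℕ.+_) (fuel (suc n) (suc (n ∸ suc p)) (n ∸ suc p) (s≤s (m∸n≤m n (suc p))) ℕP.≤-refl))

    A-recurrence : ∀ m → (A m - sh 1 A m) - sh s A m ≡ δ 0 m
    A-recurrence zero = refl
    A-recurrence (suc n) with suc n ℕ.<? s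
    ... | yes n+1<s = cong₂ _-_ (cong₂ _-_ (cong +_ (A-initial (suc n) n+1<s))
                                           (cong +_ (A-initial n (ℕP.<-trans (ℕP.n<1+n n) n+1<s))))
                                (sh-below s A (suc n) n+1<s)
    ... | no  n+1≮s = begin
      (A (suc n) - A n) - sh s A (suc n)
        ≡⟨ cong₂ _-_ (cong (λ x → + x - A n) (A-step n s≤n+1)) (sh-above s A (suc n) s≤n+1) ⟩
      (+ (aSeq s n ℕ.+ aSeq s (suc n ∸ s)) - A n) - A (suc n ∸ s)
        ≡⟨ lem (aSeq s n) (aSeq s (suc n ∸ s)) ⟩
      + 0 ∎
      where
      open ≡-Reasoning
      s≤n+1 : s ≤ suc n
      s≤n+1 = ℕP.≮⇒≥ n+1≮s
      lem : ∀ a b → (+ (a ℕ.+ b) - + a) - + b ≡ + 0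
      lem a b rewrite pos-+ a b = solve 2 (λ a b → (a :+ b :- a) :- b := con (+ 0)) refl (+ a) (+ b)

-- The generating function of the determinant entries, for r = ε + 2p + 2
-- (ε = 0, 1), computed by bisecting that of T^(r), r = q + 3.
module EntriesGF (q p : ℕ) where

  open PowerSeries
  open Bisection using (dbl)
  open SymbolicPolynomial p
  open Recurrences using (module Tribonacci)
  open Tribonacci q
  open import Data.Nat as ℕ using (ℕ; suc)
  open import Data.Product using (_,_)
  open import Data.List using ([]; _∷_; _++_)
  open import Data.Integer using (+_; -[1+_]; _+_; _*_; _-_)
  open import Data.Integer.Solver using (module +-*-Solver)
  open +-*-Solver
  open import Relation.Binary.PropositionalEquality

  -- 1 - x - x² - x^e
  tribDen : Exp → Poly
  tribDen e = (+ 1 , (0 , 0)) ∷ (-[1+ 0 ] , (1 , 0)) ∷ (-[1+ 0 ] , (2 , 0)) ∷ (-[1+ 0 ] , e) ∷ []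

  trib-gf : ∀ rE r-1E → val rE ≡ r → val r-1E ≡ suc (suc q) →
            conv (evalP (tribDen rE)) t ≈ evalP ((+ 1 , r-1E) ∷ [])
  trib-gf rE r-1E rE≡ r-1E≡ m =
    trans (conv-evalP-shifts (tribDen rE) t m)
          (trans (cong (λ e → + 1 * sh 0 t m + (-[1+ 0 ] * sh 1 t m + (-[1+ 0 ] * sh 2 t m + (-[1+ 0 ] * sh e t m + + 0)))) rE≡)
          (trans (lem (sh 0 t m) (sh 1 t m) (sh 2 t m) (sh r t m))
          (trans (t-recurrence m)
                 (trans (lem′ (δ (suc (suc q)) m)) (cong (λ e → + 1 * δ e m + + 0) (sym r-1E≡))))))
    where
    lem : ∀ a b c d → + 1 * a + (-[1+ 0 ] * b + (-[1+ 0 ] * c + (-[1+ 0 ] * d + + 0))) ≡ ((a - b) - c) - d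
    lem = solve 4 (λ a b c d → con (+ 1) :* a :+ (con -[1+ 0 ] :* b :+ (con -[1+ 0 ] :* c :+ (con -[1+ 0 ] :* d :+ con (+ 0))))
                               := ((a :- b) :- c) :- d) refl
    lem′ : ∀ x → x ≡ + 1 * x + + 0
    lem′ = solve 1 (λ x → x := con (+ 1) :* x :+ con (+ 0)) refl

  entries-gf : ∀ ε Q′ N → ε ℕ.+ dbl p ≡ suc q →
               conv (evalP Q′) (λ k → t (ε ℕ.+ dbl k)) ≈ evalP (shiftP (0 , 1) N) →
               conv (evalP Q′) (tribEntries r) ≈ evalP (N ++ Q′)
  entries-gf ε Q′ N r-2≡ bisected m = begin
    conv (evalP Q′) (tribEntries r) m
      ≡⟨ conv-congʳ (evalP Q′) _ (addS entries′ (δ 0)) (λ k → sym (lem (tribEntries r k) (δ 0 k))) m ⟩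
    conv (evalP Q′) (addS entries′ (δ 0)) m
      ≡⟨ conv-addʳ entries′ (δ 0) (evalP Q′) m ⟩
    conv (evalP Q′) entries′ m + conv (evalP Q′) (δ 0) m
      ≡⟨ cong₂ _+_ (numerator m) (conv-identityʳ (evalP Q′) m) ⟩
    evalP N m + evalP Q′ m
      ≡⟨ sym (evalP-++ N Q′ m) ⟩
    evalP (N ++ Q′) m ∎
    where
    open ≡-Reasoning
    lem : ∀ x y → (x - y) + y ≡ x
    lem = solve 2 (λ x y → (x :- y) :+ y := x) refl
    numerator : conv (evalP Q′) entries′ ≈ evalP N
    numerator = sh-injective p λ m → begin
      sh p (conv (evalP Q′) entries′) m  ≡⟨ sym (conv-sh p (evalP Q′) entries′ m) ⟩
      conv (evalP Q′) (sh p entries′) m  ≡⟨ conv-congʳ (evalP Q′) _ _ (λ k → sym (bisected-entries ε p r-2≡ k)) m ⟩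
      conv (evalP Q′) (λ k → t (ε ℕ.+ dbl k)) m ≡⟨ bisected m ⟩
      evalP (shiftP (0 , 1) N) m         ≡⟨ sym (sh-evalP (0 , 1) N m) ⟩
      sh p (evalP N) m                   ∎

-- r = 2p + 3 (here B = p, so r = 3 + 2B and h = (r+1)/2 = 2 + B).
module OddCase (p : ℕ) where

  open import Data.Nat as ℕ using (ℕ; suc)
  open PowerSeries
  open Bisection using (dbl-+)
  open SymbolicPolynomial p
  open EntriesGF (p ℕ.+ p) p
  open Recurrences.Tribonacci (p ℕ.+ p) using (t; r)
  open Hessenberg using (det-from-inverse)
  open import Data.Product using (_,_)
  open import Data.List using ([]; _∷_; _++_)
  open import Data.Integer using (+_; -[1+_]; _+_; _*_; _-_)
  open import Data.Integer.Solver using (module +-*-Solver)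
  open +-*-Solver
  open import Relation.Binary.PropositionalEquality

  h : ℕ
  h = suc (suc p)

  -- M = 1 + x - x² + x^r makes M·(1 - x - x² - x^r) = Q′(x²)
  M Q′ Num Den : Poly
  M   = (+ 1 , (0 , 0)) ∷ (+ 1 , (1 , 0)) ∷ (-[1+ 0 ] , (2 , 0)) ∷ (+ 1 , (3 , 2)) ∷ []
  Q′  = (+ 1 , (0 , 0)) ∷ (-[1+ 2 ] , (1 , 0)) ∷ (+ 1 , (2 , 0)) ∷ (-[1+ 1 ] , (2 , 1)) ∷ (-[1+ 0 ] , (3 , 2)) ∷ []
  -- x + x^h and 1 - 2x + x² - x^h - x^r
  Num = (+ 1 , (1 , 0)) ∷ (+ 1 , (2 , 1)) ∷ []
  Den = (+ 1 , (0 , 0)) ∷ (-[1+ 1 ] , (1 , 0)) ∷ (+ 1 , (2 , 0)) ∷ (-[1+ 0 ] , (2 , 1)) ∷ (-[1+ 0 ] , (3 , 2)) ∷ []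

  -- M·x^{r-1} = (x^{1+B} - x^{2+B})(x²) + x·(x^B·Num)(x²)
  open Bisect t M (tribDen (3 , 2)) ((+ 1 , (2 , 2)) ∷ []) Q′
              ((+ 1 , (1 , 1)) ∷ (-[1+ 0 ] , (2 , 1)) ∷ []) (shiftP (0 , 1) Num)
              (trib-gf (3 , 2) (2 , 2) refl refl) refl refl

  entries-quotient : conv (evalP Q′) (tribEntries r) ≈ evalP Den
  entries-quotient m =
    trans (entries-gf 1 Q′ Num (cong suc (dbl-+ p)) odd-part m) (polyEq (Num ++ Q′) Den refl m)

  kDen≈Den : ∀ m → kDen h r m ≡ evalP Den m
  kDen≈Den m = lem (δ 0 m) (δ 1 m) (δ 2 m) (δ h m) (δ r m)
    where
    lem : ∀ a b c d e → (((a - + 2 * b) + c) - d) - e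
                        ≡ + 1 * a + (-[1+ 1 ] * b + (+ 1 * c + (-[1+ 0 ] * d + (-[1+ 0 ] * e + + 0))))
    lem = solve 5 (λ a b c d e → (((a :- con (+ 2) :* b) :+ c) :- d) :- e
                    := con (+ 1) :* a :+ (con -[1+ 1 ] :* b :+ (con (+ 1) :* c :+ (con -[1+ 0 ] :* d :+ (con -[1+ 0 ] :* e :+ con (+ 0)))))) refl

  kNum≈Num : ∀ m → kNum h m ≡ evalP Num m
  kNum≈Num m = lem (δ 1 m) (δ h m)
    where
    lem : ∀ a b → a + b ≡ + 1 * a + (+ 1 * b + + 0)
    lem = solve 2 (λ a b → a :+ b := con (+ 1) :* a :+ (con (+ 1) :* b :+ con (+ 0))) refl

  one-minus-k-inverse : ∀ (k : Series) → (∀ m → conv (kDen h r) k m ≡ kNum h m) →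
                        conv (tribEntries r) (subS (δ 0) k) ≈ δ 0
  one-minus-k-inverse k hk =
    inverse-from-quotient (tribEntries r) (subS (δ 0) k) (evalP Q′) (evalP Den) refl entries-quotient λ m → begin
      conv (evalP Den) (subS (δ 0) k) m                ≡⟨ conv-subʳ (δ 0) k (evalP Den) m ⟩
      conv (evalP Den) (δ 0) m - conv (evalP Den) k m  ≡⟨ cong₂ _-_ (conv-identityʳ (evalP Den) m) (Den·k≈Num m) ⟩
      evalP Den m - evalP Num m                        ≡⟨ evalP-sub Den Num m ⟩
      evalP (Den ++ negP Num) m                        ≡⟨ polyEq (Den ++ negP Num) Q′ refl m ⟩
      evalP Q′ m                                       ∎
    where
    open ≡-Reasoning
    Den·k≈Num : conv (evalP Den) k ≈ evalP Num
    Den·k≈Num m = trans (conv-congˡ (evalP Den) (kDen h r) k (λ j → sym (kDen≈Den j)) m)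
                      (trans (hk m) (kNum≈Num m))

  odd-case : ∀ (k : Series) → (∀ m → conv (kDen h r) k m ≡ kNum h m) →
             ∀ n → thDet (suc n) (tribEntries r) ≡ sg n * k (suc n)
  odd-case k hk n =
    trans (det-from-inverse (tribEntries r) (subS (δ 0) k) refl (one-minus-k-inverse k hk) (suc n))
          (sg-suc-neg n (k (suc n)))

-- r = 2s with s = p + 1 and p = p′ + 1 (here B = p, so r = 2 + 2B and
-- s = 1 + B).
module EvenCase (p′ : ℕ) where

  open import Data.Nat as ℕ using (ℕ; suc; _∸_)
  open PowerSeries
  open Bisection using (dbl-+)
  open SymbolicPolynomial (suc p′)
  open EntriesGF (p′ ℕ.+ suc p′) (suc p′)
  open Recurrences.Tribonacci (p′ ℕ.+ suc p′) using (t; r)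
  open Recurrences.ASeq p′ using (s; A; A-recurrence)
  open Hessenberg using (det-from-inverse)
  open import Data.Fin using (toℕ)
  open import Data.Product using (_,_)
  open import Data.List using ([]; _∷_; _++_)
  open import Data.Integer using (+_; -[1+_]; _+_; _*_; _-_)
  open import Data.Integer.Properties using (pos-*; +-identityʳ; *-identityˡ)
  open import Data.Integer.Solver using (module +-*-Solver)
  open +-*-Solver
  open import Relation.Binary.PropositionalEquality

  p : ℕ
  p = suc p′

  -- M = 1 + x - x² - x^r makes M·(1 - x - x² - x^r) = Q′(x²)
  M Q′ Q X : Poly
  M  = (+ 1 , (0 , 0)) ∷ (+ 1 , (1 , 0)) ∷ (-[1+ 0 ] , (2 , 0)) ∷ (-[1+ 0 ] , (2 , 2)) ∷ []
  Q′ = (+ 1 , (0 , 0)) ∷ (-[1+ 2 ] , (1 , 0)) ∷ (+ 1 , (2 , 0)) ∷ (-[1+ 1 ] , (1 , 1)) ∷ (+ 2 , (2 , 1)) ∷ (+ 1 , (2 , 2)) ∷ []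
  -- 1 - x - x^s, and x
  Q  = (+ 1 , (0 , 0)) ∷ (-[1+ 0 ] , (1 , 0)) ∷ (-[1+ 0 ] , (1 , 1)) ∷ []
  X  = (+ 1 , (1 , 0)) ∷ []

  -- M·x^{r-1} = (x^B·x)(x²) + x·(x^B - x^{1+B} - x^{1+2B})(x²)
  open Bisect t M (tribDen (2 , 2)) ((+ 1 , (1 , 2)) ∷ []) Q′
              (shiftP (0 , 1) X) ((+ 1 , (0 , 1)) ∷ (-[1+ 0 ] , (1 , 1)) ∷ (-[1+ 0 ] , (1 , 2)) ∷ [])
              (trib-gf (2 , 2) (1 , 2) refl refl) refl refl

  entries-quotient : conv (evalP Q′) (tribEntries r) ≈ evalP (Q ⊗ Q)
  entries-quotient m =
    trans (entries-gf 0 Q′ X (dbl-+ p) even-part m) (polyEq (X ++ Q′) (Q ⊗ Q) refl m)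

  Q·A≈1 : conv (evalP Q) A ≈ δ 0
  Q·A≈1 m = trans (conv-evalP-shifts Q A m)
                  (trans (lem (sh 0 A m) (sh 1 A m) (sh s A m)) (A-recurrence m))
    where
    lem : ∀ a b c → + 1 * a + (-[1+ 0 ] * b + (-[1+ 0 ] * c + + 0)) ≡ (a - b) - c
    lem = solve 3 (λ a b c → con (+ 1) :* a :+ (con -[1+ 0 ] :* b :+ (con -[1+ 0 ] :* c :+ con (+ 0)))
                             := (a :- b) :- c) refl

  W : Series
  W = subS (δ 0) (sh 1 (conv A A))

  -- Q²·W = Q² - x·(Q A)² = Q² - x = Q′, so W is the inverse of the entry series.
  W-inverse : conv (tribEntries r) W ≈ δ 0
  W-inverse = inverse-from-quotient (tribEntries r) W (evalP Q′) (evalP (Q ⊗ Q)) refl entries-quotient λ m → begin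
    conv (evalP (Q ⊗ Q)) W m
      ≡⟨ conv-subʳ (δ 0) (sh 1 (conv A A)) (evalP (Q ⊗ Q)) m ⟩
    conv (evalP (Q ⊗ Q)) (δ 0) m - conv (evalP (Q ⊗ Q)) (sh 1 (conv A A)) m
      ≡⟨ cong₂ _-_ (conv-identityʳ (evalP (Q ⊗ Q)) m)
                   (trans (conv-sh 1 (evalP (Q ⊗ Q)) (conv A A) m) (x·Q²A² m)) ⟩
    evalP (Q ⊗ Q) m - evalP X m       ≡⟨ evalP-sub (Q ⊗ Q) X m ⟩
    evalP ((Q ⊗ Q) ++ negP X) m       ≡⟨ polyEq ((Q ⊗ Q) ++ negP X) Q′ refl m ⟩
    evalP Q′ m                        ∎
    where
    open ≡-Reasoning
    Q²A²≈1 : conv (evalP (Q ⊗ Q)) (conv A A) ≈ δ 0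
    Q²A²≈1 k = trans (conv-congˡ (evalP (Q ⊗ Q)) (conv (evalP Q) (evalP Q)) (conv A A) (λ j → sym (conv-evalP Q Q j)) k)
                     (conv-inverse-product (evalP Q) (evalP Q) A A Q·A≈1 Q·A≈1 k)
    x·Q²A² : ∀ m → sh 1 (conv (evalP (Q ⊗ Q)) (conv A A)) m ≡ evalP X m
    x·Q²A² ℕ.zero    = refl
    x·Q²A² (suc m) = trans (Q²A²≈1 m) (sym (trans (+-identityʳ _) (*-identityˡ _)))

  even-case : ∀ n → thDet (suc n) (tribEntries r)
                    ≡ sg n * sumℤ (suc n) (λ i → + (aSeq s (toℕ i) ℕ.* aSeq s (n ∸ toℕ i)))
  even-case n = begin
    thDet (suc n) (tribEntries r) ≡⟨ det-from-inverse (tribEntries r) W refl W-inverse (suc n) ⟩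
    sg (suc n) * (+ 0 - conv A A n) ≡⟨ sg-suc-neg n (conv A A n) ⟩
    sg n * conv A A n ≡⟨ cong (sg n *_) (sumℤ-cong (suc n) _ _ (λ i → sym (pos-* (aSeq s (toℕ i)) (aSeq s (n ∸ toℕ i))))) ⟩
    sg n * sumℤ (suc n) (λ i → + (aSeq s (toℕ i) ℕ.* aSeq s (n ∸ toℕ i))) ∎
    where open ≡-Reasoning

module IntegerEmbedding where

  open import Data.Nat as ℕ using (suc)
  open import Data.Nat.Coprimality using (sym; 1-coprimeTo)
  open import Data.Integer as ℤ using (ℤ; +_; -[1+_])
  open import Data.Integer.Properties using (*-identityʳ)
  open import Data.Rational as ℚ using (ℚ; mkℚ)
  open import Data.Rational.Properties using (normalize-coprime)
  open import Relation.Binary.PropositionalEquality hiding (sym)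
  import Relation.Binary.PropositionalEquality as Eq

  ι : ℤ → ℚ
  ι z = z ℚ./ 1

  ι-mkℚ : ∀ z → ι z ≡ mkℚ z 0 (sym (1-coprimeTo ℤ.∣ z ∣))
  ι-mkℚ (+ n)    = normalize-coprime (sym (1-coprimeTo n))
  ι-mkℚ -[1+ n ] = cong ℚ.-_ (normalize-coprime (sym (1-coprimeTo (suc n))))

  ι-+ : ∀ a b → ι (a ℤ.+ b) ≡ ι a ℚ.+ ι b
  ι-+ a b rewrite ι-mkℚ a | ι-mkℚ b =
    cong ι (cong₂ ℤ._+_ (Eq.sym (*-identityʳ a)) (Eq.sym (*-identityʳ b)))

  ι-* : ∀ a b → ι (a ℤ.* b) ≡ ι a ℚ.* ι b
  ι-* a b rewrite ι-mkℚ a | ι-mkℚ b = refl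

-- With w i = 2^{-(i + ⌊i/2⌋)}, the sums
-- c N = Σ_{i≤N} w i · C(N-i, ⌊i/2⌋) satisfy c_{N+3} = c_{N+2} + c_N/8 by
-- Pascal's rule, so 2^N c_N satisfies the recurrence k_{n+3} = 2k_{n+2} + k_n
-- of the numbers kₙ for r = 3.
module TribonacciClosedForm where

  open PowerSeries
  open IntegerEmbedding
  open import Data.Nat as ℕ using (ℕ; zero; suc; _∸_; _/_)
  import Data.Nat.Properties as ℕP
  open import Data.Nat.DivMod using (m/n≡1+[m∸n]/n)
  open import Data.Nat.Combinatorics using (_C_; nCk+nC[k+1]≡[n+1]C[k+1])
  open import Data.Fin as Fin using (Fin; toℕ)
  open import Data.Integer as ℤ using (ℤ; +_; -[1+_])
  import Data.Integer.Properties as ℤP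
  import Data.Integer.Solver
  module ℤS = Data.Integer.Solver.+-*-Solver
  open import Data.Rational as ℚ using (ℚ; ½; 0ℚ; 1ℚ)
  import Data.Rational.Properties as ℚP
  import Data.Rational.Solver
  module ℚS = Data.Rational.Solver.+-*-Solver
  open import Relation.Binary.PropositionalEquality

  sumℚ-cong : ∀ n (f g : Fin n → ℚ) → (∀ i → f i ≡ g i) → sumℚ n f ≡ sumℚ n g
  sumℚ-cong zero    f g e = refl
  sumℚ-cong (suc n) f g e = cong₂ ℚ._+_ (e Fin.zero) (sumℚ-cong n _ _ (λ i → e (Fin.suc i)))

  diag : (ℕ → ℕ → ℚ) → ℕ → ℚ
  diag f N = sumℚ (suc N) (λ i → f (toℕ i) (N ∸ toℕ i))

  diag-scal : ∀ q f N → diag (λ i M → q ℚ.* f i M) N ≡ q ℚ.* diag f N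
  diag-scal q f zero    = trans (ℚP.+-identityʳ _) (cong (q ℚ.*_) (sym (ℚP.+-identityʳ _)))
  diag-scal q f (suc N) =
    trans (cong (q ℚ.* f 0 (suc N) ℚ.+_) (diag-scal q (λ i M → f (suc i) M) N))
          (sym (ℚP.*-distribˡ-+ q (f 0 (suc N)) (diag (λ i M → f (suc i) M) N)))

  diag-pascal : ∀ f f′ → (∀ i M → f i (suc M) ≡ f i M ℚ.+ f′ i M) →
                ∀ N → diag f (suc N) ≡ (diag f N ℚ.+ diag f′ N) ℚ.+ f (suc N) 0
  diag-pascal f f′ step zero = begin
    f 0 1 ℚ.+ (f 1 0 ℚ.+ 0ℚ)         ≡⟨ cong₂ ℚ._+_ (step 0 0) (ℚP.+-identityʳ (f 1 0)) ⟩
    (f 0 0 ℚ.+ f′ 0 0) ℚ.+ f 1 0     ≡⟨ cong (ℚ._+ f 1 0) (sym (cong₂ ℚ._+_ (ℚP.+-identityʳ (f 0 0)) (ℚP.+-identityʳ (f′ 0 0)))) ⟩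
    ((f 0 0 ℚ.+ 0ℚ) ℚ.+ (f′ 0 0 ℚ.+ 0ℚ)) ℚ.+ f 1 0 ∎
    where open ≡-Reasoning
  diag-pascal f f′ step (suc N) = begin
    f 0 (suc (suc N)) ℚ.+ diag f₁ (suc N)
      ≡⟨ cong₂ ℚ._+_ (step 0 (suc N)) (diag-pascal f₁ f′₁ (λ i M → step (suc i) M) N) ⟩
    (f 0 (suc N) ℚ.+ f′ 0 (suc N)) ℚ.+ ((diag f₁ N ℚ.+ diag f′₁ N) ℚ.+ f (suc (suc N)) 0)
      ≡⟨ ℚS.solve 5 (λ a b x y z → (a ℚS.:+ b) ℚS.:+ ((x ℚS.:+ y) ℚS.:+ z) ℚS.:= ((a ℚS.:+ x) ℚS.:+ (b ℚS.:+ y)) ℚS.:+ z) refl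
                    (f 0 (suc N)) (f′ 0 (suc N)) (diag f₁ N) (diag f′₁ N) (f (suc (suc N)) 0) ⟩
    ((f 0 (suc N) ℚ.+ diag f₁ N) ℚ.+ (f′ 0 (suc N) ℚ.+ diag f′₁ N)) ℚ.+ f (suc (suc N)) 0 ∎
    where
    open ≡-Reasoning
    f₁ f′₁ : ℕ → ℕ → ℚ
    f₁ i M = f (suc i) M
    f′₁ i M = f′ (suc i) M

  powℚ-+ : ∀ q x y → powℚ q (x ℕ.+ y) ≡ powℚ q x ℚ.* powℚ q y
  powℚ-+ q zero    y = sym (ℚP.*-identityˡ _)
  powℚ-+ q (suc x) y = trans (cong (q ℚ.*_) (powℚ-+ q x y)) (sym (ℚP.*-assoc q (powℚ q x) (powℚ q y)))

  eighth : ℚ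
  eighth = powℚ ½ 3

  w : ℕ → ℚ
  w i = powℚ ½ (i ℕ.+ i / 2)

  term : ℕ → ℕ → ℚ
  term i M = w i ℚ.* ι (+ (M C (i / 2)))

  c : ℕ → ℚ
  c = diag term

  half-suc-suc : ∀ i → suc (suc i) / 2 ≡ suc (i / 2)
  half-suc-suc i = m/n≡1+[m∸n]/n {suc (suc i)} {2} (ℕ.s≤s (ℕ.s≤s ℕ.z≤n))

  w-suc-suc : ∀ i → w (suc (suc i)) ≡ w i ℚ.* eighth
  w-suc-suc i = begin
    powℚ ½ (suc (suc i) ℕ.+ suc (suc i) / 2) ≡⟨ cong (λ z → powℚ ½ (suc (suc i) ℕ.+ z)) (half-suc-suc i) ⟩
    powℚ ½ (suc (suc i) ℕ.+ suc (i / 2))     ≡⟨ cong (powℚ ½) (exponent i (i / 2)) ⟩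
    powℚ ½ ((i ℕ.+ i / 2) ℕ.+ 3)             ≡⟨ powℚ-+ ½ (i ℕ.+ i / 2) 3 ⟩
    w i ℚ.* eighth                           ∎
    where
    open ≡-Reasoning
    exponent : ∀ i j → suc (suc i) ℕ.+ suc j ≡ (i ℕ.+ j) ℕ.+ 3
    exponent i j = trans (cong suc (cong suc (ℕP.+-suc i j))) (ℕP.+-comm 3 (i ℕ.+ j))

  -- the increments of term in its second argument (Pascal's rule)
  increment : ℕ → ℕ → ℚ
  increment zero          M = 0ℚ
  increment (suc zero)    M = 0ℚ
  increment (suc (suc i)) M = eighth ℚ.* term i M

  term-pascal : ∀ i M → term i (suc M) ≡ term i M ℚ.+ increment i M
  term-pascal zero          M = sym (ℚP.+-identityʳ _)
  term-pascal (suc zero)    M = sym (ℚP.+-identityʳ _)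
  term-pascal (suc (suc i)) M = begin
    w (suc (suc i)) ℚ.* ι (+ (suc M C (suc (suc i) / 2)))
      ≡⟨ cong (λ z → w (suc (suc i)) ℚ.* ι (+ (suc M C z))) (half-suc-suc i) ⟩
    w (suc (suc i)) ℚ.* ι (+ (suc M C suc j))
      ≡⟨ cong (λ z → w (suc (suc i)) ℚ.* ι (+ z)) (sym (nCk+nC[k+1]≡[n+1]C[k+1] M j)) ⟩
    w (suc (suc i)) ℚ.* ι (+ (M C j ℕ.+ M C suc j))
      ≡⟨ cong₂ ℚ._*_ (w-suc-suc i) (trans (cong ι (ℤP.pos-+ (M C j) (M C suc j))) (ι-+ (+ (M C j)) (+ (M C suc j)))) ⟩
    (w i ℚ.* eighth) ℚ.* (ι (+ (M C j)) ℚ.+ ι (+ (M C suc j)))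
      ≡⟨ ℚS.solve 4 (λ a b x y → (a ℚS.:* b) ℚS.:* (x ℚS.:+ y) ℚS.:= (a ℚS.:* b) ℚS.:* y ℚS.:+ b ℚS.:* (a ℚS.:* x)) refl
                    (w i) eighth (ι (+ (M C j))) (ι (+ (M C suc j))) ⟩
    (w i ℚ.* eighth) ℚ.* ι (+ (M C suc j)) ℚ.+ eighth ℚ.* term i M
      ≡⟨ cong (ℚ._+ eighth ℚ.* term i M)
              (sym (trans (cong (λ z → w (suc (suc i)) ℚ.* ι (+ (M C z))) (half-suc-suc i))
                          (cong (ℚ._* ι (+ (M C suc j))) (w-suc-suc i)))) ⟩
    term (suc (suc i)) M ℚ.+ increment (suc (suc i)) M ∎
    where
    open ≡-Reasoning
    j = i / 2

  c-recurrence : ∀ N → c (suc (suc (suc N))) ≡ c (suc (suc N)) ℚ.+ eighth ℚ.* c N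
  c-recurrence N = begin
    diag term (suc (suc (suc N)))
      ≡⟨ diag-pascal term increment term-pascal (suc (suc N)) ⟩
    (diag term (suc (suc N)) ℚ.+ diag increment (suc (suc N))) ℚ.+ term (suc (suc (suc N))) 0
      ≡⟨ cong₂ (λ x y → (diag term (suc (suc N)) ℚ.+ x) ℚ.+ y) increments last-vanishes ⟩
    (c (suc (suc N)) ℚ.+ eighth ℚ.* c N) ℚ.+ 0ℚ
      ≡⟨ ℚP.+-identityʳ _ ⟩
    c (suc (suc N)) ℚ.+ eighth ℚ.* c N ∎
    where
    open ≡-Reasoning
    increments : diag increment (suc (suc N)) ≡ eighth ℚ.* c N
    increments = trans (trans (ℚP.+-identityˡ _) (ℚP.+-identityˡ _)) (diag-scal eighth term N)
    last-vanishes : term (suc (suc (suc N))) 0 ≡ 0ℚ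
    last-vanishes = trans (cong (λ z → w (suc (suc (suc N))) ℚ.* ι (+ (0 C z))) (half-suc-suc (suc N)))
                          (ℚP.*-zeroʳ (w (suc (suc (suc N)))))

  K : ℕ → ℤ
  K zero                = + 0
  K (suc zero)          = + 1
  K (suc (suc zero))    = + 3
  K (suc (suc (suc n))) = + 2 ℤ.* K (suc (suc n)) ℤ.+ K n

  open OddCase 0 using (Den; Num; kDen≈Den; kNum≈Num; odd-case)
  open SymbolicPolynomial 0 using (evalP; shifts; conv-evalP-shifts)

  K-gf : ∀ m → conv (kDen 2 3) K m ≡ kNum 2 m
  K-gf m = trans (conv-congˡ (kDen 2 3) (evalP Den) K kDen≈Den m)
                 (trans (conv-evalP-shifts Den K m) (trans (coefficient m) (sym (kNum≈Num m))))
    where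
    coefficient : ∀ m → shifts Den K m ≡ evalP Num m
    coefficient zero                = refl
    coefficient (suc zero)          = refl
    coefficient (suc (suc zero))    = refl
    coefficient (suc (suc (suc n))) = lem (K (suc (suc n))) (K (suc n)) (K n)
      where
      lem : ∀ a b c → + 1 ℤ.* (+ 2 ℤ.* a ℤ.+ c) ℤ.+ (-[1+ 1 ] ℤ.* a ℤ.+ (+ 1 ℤ.* b ℤ.+ (-[1+ 0 ] ℤ.* b ℤ.+ (-[1+ 0 ] ℤ.* c ℤ.+ + 0)))) ≡ + 0
      lem = ℤS.solve 3 (λ a b c → ℤS.con (+ 1) ℤS.:* (ℤS.con (+ 2) ℤS.:* a ℤS.:+ c)
                         ℤS.:+ (ℤS.con -[1+ 1 ] ℤS.:* a ℤS.:+ (ℤS.con (+ 1) ℤS.:* b ℤS.:+ (ℤS.con -[1+ 0 ] ℤS.:* b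
                         ℤS.:+ (ℤS.con -[1+ 0 ] ℤS.:* c ℤS.:+ ℤS.con (+ 0))))) ℤS.:= ℤS.con (+ 0)) refl

  -- 2^N c_N satisfies the recurrence of k_{N+1} and has the same initial values
  v : ℕ → ℚ
  v N = ι ((+ 2) ℤ.^ N) ℚ.* c N

  v-recurrence : ∀ N → v (suc (suc (suc N))) ≡ ι (+ 2) ℚ.* v (suc (suc N)) ℚ.+ v N
  v-recurrence N = begin
    ι (two^ (suc (suc (suc N)))) ℚ.* c (suc (suc (suc N)))
      ≡⟨ cong₂ ℚ._*_ (trans (ι-* (+ 2) (two^ (suc (suc N))))
                            (cong (t ℚ.*_) (trans (ι-* (+ 2) (two^ (suc N))) (cong (t ℚ.*_) (ι-* (+ 2) (two^ N))))))
                     (c-recurrence N) ⟩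
    (t ℚ.* (t ℚ.* (t ℚ.* x))) ℚ.* (y ℚ.+ eighth ℚ.* z)
      ≡⟨ ℚS.solve 5 (λ t x y z e → (t ℚS.:* (t ℚS.:* (t ℚS.:* x))) ℚS.:* (y ℚS.:+ e ℚS.:* z)
                     ℚS.:= t ℚS.:* ((t ℚS.:* (t ℚS.:* x)) ℚS.:* y) ℚS.:+ (t ℚS.:* (t ℚS.:* (t ℚS.:* e))) ℚS.:* (x ℚS.:* z))
                    refl t x y z eighth ⟩
    t ℚ.* ((t ℚ.* (t ℚ.* x)) ℚ.* y) ℚ.+ (t ℚ.* (t ℚ.* (t ℚ.* eighth))) ℚ.* (x ℚ.* z)
      ≡⟨ cong₂ (λ a b → t ℚ.* (a ℚ.* y) ℚ.+ b ℚ.* (x ℚ.* z))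
               (sym (trans (ι-* (+ 2) (two^ (suc N))) (cong (t ℚ.*_) (ι-* (+ 2) (two^ N)))))
               eight·eighth ⟩
    t ℚ.* v (suc (suc N)) ℚ.+ 1ℚ ℚ.* v N
      ≡⟨ cong (t ℚ.* v (suc (suc N)) ℚ.+_) (ℚP.*-identityˡ (v N)) ⟩
    t ℚ.* v (suc (suc N)) ℚ.+ v N ∎
    where
    open ≡-Reasoning
    two^ : ℕ → ℤ
    two^ n = (+ 2) ℤ.^ n
    t = ι (+ 2)
    x = ι (two^ N)
    y = c (suc (suc N))
    z = c N
    eight·eighth : t ℚ.* (t ℚ.* (t ℚ.* eighth)) ≡ 1ℚ
    eight·eighth = refl

  v≡K : ∀ N → v N ≡ ι (K (suc N))
  v≡K zero                = refl
  v≡K (suc zero)          = refl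
  v≡K (suc (suc zero))    = refl
  v≡K (suc (suc (suc N))) = begin
    v (suc (suc (suc N)))                                  ≡⟨ v-recurrence N ⟩
    ι (+ 2) ℚ.* v (suc (suc N)) ℚ.+ v N                    ≡⟨ cong₂ (λ a b → ι (+ 2) ℚ.* a ℚ.+ b) (v≡K (suc (suc N))) (v≡K N) ⟩
    ι (+ 2) ℚ.* ι (K (suc (suc (suc N)))) ℚ.+ ι (K (suc N)) ≡⟨ cong (ℚ._+ ι (K (suc N))) (sym (ι-* (+ 2) (K (suc (suc (suc N)))))) ⟩
    ι (+ 2 ℤ.* K (suc (suc (suc N)))) ℚ.+ ι (K (suc N))    ≡⟨ sym (ι-+ (+ 2 ℤ.* K (suc (suc (suc N)))) (K (suc N))) ⟩
    ι (K (suc (suc (suc (suc N)))))                        ∎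
    where open ≡-Reasoning

  sg·two^ : ∀ N → sg N ℤ.* (+ 2) ℤ.^ N ≡ (ℤ.- (+ 2)) ℤ.^ N
  sg·two^ zero    = refl
  sg·two^ (suc N) =
    trans (ℤS.solve 2 (λ s x → (ℤS.:- ℤS.con (+ 1) ℤS.:* s) ℤS.:* (ℤS.con (+ 2) ℤS.:* x)
                              ℤS.:= ℤS.con (ℤ.- (+ 2)) ℤS.:* (s ℤS.:* x)) refl (sg N) ((+ 2) ℤ.^ N))
          (cong ((ℤ.- (+ 2)) ℤ.*_) (sg·two^ N))

  closed-form : ∀ N → ι (thDet (suc N) (tribEntries 3)) ≡ ι ((ℤ.- (+ 2)) ℤ.^ N) ℚ.* c N
  closed-form N = begin
    ι (thDet (suc N) (tribEntries 3))             ≡⟨ cong ι (odd-case K K-gf N) ⟩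
    ι (sg N ℤ.* K (suc N))                        ≡⟨ ι-* (sg N) (K (suc N)) ⟩
    ι (sg N) ℚ.* ι (K (suc N))                    ≡⟨ cong (ι (sg N) ℚ.*_) (sym (v≡K N)) ⟩
    ι (sg N) ℚ.* (ι ((+ 2) ℤ.^ N) ℚ.* c N)        ≡⟨ sym (ℚP.*-assoc (ι (sg N)) (ι ((+ 2) ℤ.^ N)) (c N)) ⟩
    (ι (sg N) ℚ.* ι ((+ 2) ℤ.^ N)) ℚ.* c N        ≡⟨ cong (ℚ._* c N) (trans (sym (ι-* (sg N) ((+ 2) ℤ.^ N))) (cong ι (sg·two^ N))) ⟩
    ι ((ℤ.- (+ 2)) ℤ.^ N) ℚ.* c N                 ∎
    where open ≡-Reasoning

-- The three parts in the variables of the statement: r = 2s + 1 is OddCase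
-- with p = s - 1, r = 2s is EvenCase with p′ = s - 2, and r = 3 is the closed form.
module Cases where

  open import Data.Nat as ℕ using (ℕ; zero; suc; _∸_; _≤_; s≤s; _/_)
  open import Data.Nat.Combinatorics using (_C_)
  open import Data.Rational as ℚ using (ℚ; ½)
  import Data.Nat.Solver
  module ℕS = Data.Nat.Solver.+-*-Solver
  open import Data.Fin using (toℕ)
  open import Data.Integer as ℤ using (ℤ; +_; -_)
  open import Relation.Binary.PropositionalEquality

  odd-theorem : ∀ s r n → r ≡ suc (2 ℕ.* s) → 3 ≤ r → 1 ≤ n →
                (k : ℕ → ℤ) → ((m : ℕ) → conv (kDen (suc s) r) k m ≡ kNum (suc s) m) →
                thDet n (tribEntries r) ≡ ((- (+ 1)) ℤ.^ (n ∸ 1)) ℤ.* k n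
  odd-theorem zero    _ _       refl (s≤s ())       _
  odd-theorem (suc p) r (suc n) r≡ _ _ k hk with trans r≡ (r-odd p)
    where
    r-odd : ∀ p → suc (2 ℕ.* suc p) ≡ 3 ℕ.+ (p ℕ.+ p)
    r-odd p = ℕS.solve 1 (λ p → ℕS.con 1 ℕS.:+ ℕS.con 2 ℕS.:* (ℕS.con 1 ℕS.:+ p) ℕS.:= ℕS.con 3 ℕS.:+ (p ℕS.:+ p)) refl p
  ... | refl = OddCase.odd-case p k hk n

  even-theorem : ∀ s r n → r ≡ 2 ℕ.* s → 3 ≤ r → 1 ≤ n →
                 thDet n (tribEntries r)
                   ≡ ((- (+ 1)) ℤ.^ (n ∸ 1)) ℤ.* sumℤ n (λ i → + (aSeq s (toℕ i) ℕ.* aSeq s (n ∸ 1 ∸ toℕ i)))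
  even-theorem zero             _ _       refl ()             _
  even-theorem (suc zero)       _ _       refl (s≤s (s≤s ())) _
  even-theorem (suc (suc p′)) r (suc n) r≡ _ _ with trans r≡ (r-even p′)
    where
    r-even : ∀ p′ → 2 ℕ.* suc (suc p′) ≡ 3 ℕ.+ (p′ ℕ.+ suc p′)
    r-even p′ = ℕS.solve 1 (λ p → ℕS.con 2 ℕS.:* (ℕS.con 2 ℕS.:+ p) ℕS.:= ℕS.con 3 ℕS.:+ (p ℕS.:+ (ℕS.con 1 ℕS.:+ p))) refl p′
  ... | refl = EvenCase.even-case p′ n

  r≡3-theorem : (n : ℕ) → 1 ≤ n →
    (thDet n (tribEntries 3) ℚ./ 1)
      ≡ (((- (+ 2)) ℤ.^ (n ∸ 1)) ℚ./ 1)
        ℚ.* sumℚ n (λ i → powℚ ½ (toℕ i ℕ.+ (toℕ i / 2)) ℚ.* ((+ ((n ∸ 1 ∸ toℕ i) C (toℕ i / 2))) ℚ./ 1))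
  r≡3-theorem (suc N) _ = TribonacciClosedForm.closed-form N

theorem8 :
    ((r n : ℕ) → 3 ≤ r → 1 ≤ n →
      ((s : ℕ) → r ≡ suc (2 Data.Nat.* s) →
        (k : ℕ → ℤ) → k 0 ≡ + 0 →
        ((m : ℕ) → conv (kDen (suc s) r) k m ≡ kNum (suc s) m) →
        thDet n (tribEntries r) ≡ ((- (+ 1)) ℤ.^ (n ∸ 1)) ℤ.* k n)
      ×
      ((s : ℕ) → r ≡ 2 Data.Nat.* s →
        thDet n (tribEntries r)
          ≡ ((- (+ 1)) ℤ.^ (n ∸ 1))
            ℤ.* sumℤ n (λ i → + (aSeq s (toℕ i) Data.Nat.* aSeq s (n ∸ 1 ∸ toℕ i)))))
    ×
    ((n : ℕ) → 1 ≤ n →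
      (thDet n (tribEntries 3) ℚ./ 1)
        ≡ (((- (+ 2)) ℤ.^ (n ∸ 1)) ℚ./ 1)
          ℚ.* sumℚ n (λ i →
                powℚ ½ (toℕ i Data.Nat.+ (toℕ i / 2))
                ℚ.* ((+ ((n ∸ 1 ∸ toℕ i) C (toℕ i / 2))) ℚ./ 1)))
theorem8 = (λ r n 3≤r 1≤n →
               (λ s r≡ k _ hk → Cases.odd-theorem s r n r≡ 3≤r 1≤n k hk) ,
               (λ s r≡ → Cases.even-theorem s r n r≡ 3≤r 1≤n)) ,
           Cases.r≡3-theorem
  where open import Data.Product using (_,_)
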